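{- For every packed word $w$, the labeled biplane forest $F_{BR}(w)$ is the mirror image of $F_{RB}(w)$, i.e. $F_{BR}(w)=\widetilde{F_{RB}(w)}$.
   Context: Words over positive integers; $\max(w)$ largest letter ($\max(\varepsilon)=0$), $w^{[k]}$ adds $k$ to all letters; packed = all integers $1..\max(w)$ occur. $u\odot v=u^{[\max(v)]}\cdot v$. Global descent of $w$ of length $n$: $1\le c\le n-1$ with all of $w_1..w_c$ strictly greater than all of $w_{c+1}..w_n$; irreducible = nonempty, no global descent; each packed $w$ is uniquely $w_1\odot\cdots\odot w_k$ with irreducible $w_j$. For packed $w$ of length $n$, $I=\{i_1<\dots<i_p\}\subseteq\{1..n+p\}$, $p\ge1$, $\phi_I(w)$ places letter $\max(w)+1$ at the positions in $I$ and the letters of $w$ in order elsewhere; a nonempty packed $v$ is uniquely $\phi_I(v')$ and $u\triangleleft_R v=\phi_{I+|u|}(u\odot v')$ with $I+|u|=\{i+|u|\}$. $\psi_{i^\circ}(w)$ ($1\le i\le\max(w)+1$) adds 1 to letters $\ge i$ and appends $i$; $\psi_{i^\bullet}(w)=w\cdot i$ ($1\le i\le\max(w)$); nonempty packed $v$ is uniquely $\psi_{i^\alpha}(v')$ and $u\triangleleft_B v=\psi_{(i+\max(u))^\alpha}(v'\odot u)$. For irreducible $w$, the red- (resp. blue-) factorization is the unique pair $(u,v)$, $v\neq\varepsilon$, $w=u\triangleleft_R v$ (resp. $u\triangleleft_B v$) with $|u|$ maximal. Red-blue-factorization of irreducible $w$: $w=a\triangleleft_R(b\triangleleft_B c)$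 with $(a,x)$ the red-factorization of $w$ and $(b,c)$ the blue-factorization of $x$; blue-red-factorization: $w=b\triangleleft_B(a\triangleleft_R c)$ with $(b,y)$ the blue-factorization of $w$ and $(a,c)$ the red-factorization of $y$. Labeled biplane trees $\mathrm{Node}(z,f_\ell,f_r)$ (root label $z$, ordered possibly empty left/right forests), forests = ordered lists. $F_{RB}(\varepsilon)=F_{BR}(\varepsilon)=[]$; for $w=w_1\odot\cdots\odot w_k$, $F_{RB}(w)=[T_{RB}(w_1),\dots,T_{RB}(w_k)]$, $F_{BR}(w)=[T_{BR}(w_k),\dots,T_{BR}(w_1)]$; for irreducible $w$, $T_{RB}(w)=\mathrm{Node}(c,F_{RB}(a),F_{RB}(b))$ where $a\triangleleft_R(b\triangleleft_B c)$ is its red-blue-factorization, and $T_{BR}(w)=\mathrm{Node}(c,F_{BR}(b),F_{BR}(a))$ where $b\triangleleft_B(a\triangleleft_R c)$ is its blue-red-factorization. Mirror: $\widetilde{[t_1,\dots,t_k]}=[\widetilde{t_k},\dots,\widetilde{t_1}]$, and $\widetilde{\mathrm{Node}(z,f_\ell,f_r)}=\mathrm{Node}(z,\widetilde{f_r},\widetilde{f_\ell})$ if $z\ne1$, $=\mathrm{Node}(1,\widetilde{f_\ell},[])$ if $z=1$ (here $1$ is the packed word of length one). (In the paper the edges of $F_{RB}$-trees to left/right children are colored red/blue and those of $F_{BR}$-trees blue/red; the comparison is of the underlying labeled biplane forests.) -}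

module Defs where

open import Data.Nat using (ℕ; zero; suc; _+_; _≤_; _<_; _⊔_)
open import Data.Bool using (Bool; true; false)
open import Data.List using (List; []; _∷_; [_]; _++_; map; foldr; length; take; drop; replicate; reverse)
open import Data.List.Properties using (≡-dec)
open import Data.List.Relation.Unary.All using (All)
open import Data.List.Membership.Propositional using (_∈_)
open import Data.Product using (Σ; _×_; _,_; ∃)
open import Relation.Binary.PropositionalEquality using (_≡_; _≢_)
open import Relation.Nullary using (¬_; yes; no)
import Data.Nat as ℕ

Word : Set
Word = List ℕ

maxW : Word → ℕ
maxW = foldr _⊔_ 0

shift : ℕ → Word → Word
shift k = map (k +_)

Packed : Word → Set
Packed w = All (λ x → 1 ≤ x) w × (∀ i → 1 ≤ i → i ≤ maxW w → i ∈ w)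

infixr 6 _⊙_
_⊙_ : Word → Word → Word
u ⊙ v = shift (maxW v) u ++ v

GlobalDescent : Word → ℕ → Set
GlobalDescent w c =
  1 ≤ c × c < length w × All (λ x → All (λ y → y < x) (drop c w)) (take c w)

Irreducible : Word → Set
Irreducible w = w ≢ [] × ¬ (∃ λ c → GlobalDescent w c)

⊙-prod : List Word → Word
⊙-prod = foldr _⊙_ []

IrrDecomp : Word → List Word → Set
IrrDecomp w ws = All (λ x → Packed x × Irreducible x) ws × w ≡ ⊙-prod ws

-- φ_I.  A set I = {i₁<…<i_p} ⊆ {1..n+p} is encoded by its characteristic
-- mask (a list of booleans of length n+p with exactly p entries true).

trues : List Bool → ℕ
trues [] = 0
trues (true ∷ bs) = suc (trues bs)
trues (false ∷ bs) = trues bs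

ValidMask : List Bool → Word → Set
ValidMask I w = length I ≡ length w + trues I × 1 ≤ trues I

place : ℕ → List Bool → Word → Word
place m [] w = []
place m (true ∷ I) w = m ∷ place m I w
place m (false ∷ I) [] = []
place m (false ∷ I) (x ∷ w) = x ∷ place m I w

φ : List Bool → Word → Word
φ I w = place (suc (maxW w)) I w

shiftMask : ℕ → List Bool → List Bool
shiftMask k I = replicate k false ++ I

RedProd : Word → Word → Word → Set
RedProd u v x = Σ (List Bool) λ I → Σ Word λ v' →
  Packed v' × ValidMask I v' × v ≡ φ I v' ×
  x ≡ φ (shiftMask (length u) I) (u ⊙ v')

data Colour : Set where
  ○ ● : Colour

bump : ℕ → ℕ → ℕ
bump i x with i ℕ.≤? x
... | yes _ = suc x
... | no  _ = x

ψ : Colour → ℕ → Word → Word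
ψ ○ i w = map (bump i) w ++ [ i ]
ψ ● i w = w ++ [ i ]

ValidIdx : Colour → ℕ → Word → Set
ValidIdx ○ i w = 1 ≤ i × i ≤ suc (maxW w)
ValidIdx ● i w = 1 ≤ i × i ≤ maxW w

BlueProd : Word → Word → Word → Set
BlueProd u v x = Σ Colour λ α → Σ ℕ λ i → Σ Word λ v' →
  Packed v' × ValidIdx α i v' × v ≡ ψ α i v' ×
  x ≡ ψ α (i + maxW u) (v' ⊙ u)

IsFact : (Word → Word → Word → Set) → Word → Word → Word → Set
IsFact P w u v =
  Packed u × Packed v × v ≢ [] × P u v w ×
  (∀ u' v' → Packed u' → Packed v' → v' ≢ [] → P u' v' w → length u' ≤ length u)

IsRedFact IsBlueFact : Word → Word → Word → Set
IsRedFact  = IsFact RedProd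
IsBlueFact = IsFact BlueProd

RBFact : Word → Word → Word → Word → Set
RBFact w a b c = Σ Word λ x → IsRedFact w a x × IsBlueFact x b c

BRFact : Word → Word → Word → Word → Set
BRFact w b a c = Σ Word λ y → IsBlueFact w b y × IsRedFact y a c

data Tree : Set where
  node : Word → List Tree → List Tree → Tree

Forest : Set
Forest = List Tree

mutual
  mirrorF : Forest → Forest
  mirrorF [] = []
  mirrorF (t ∷ ts) = mirrorF ts ++ [ mirrorT t ]

  mirrorT : Tree → Tree
  mirrorT (node z fl fr) with ≡-dec ℕ._≟_ z [ 1 ]
  ... | yes _ = node z (mirrorF fl) []
  ... | no  _ = node z (mirrorF fr) (mirrorF fl)

-- F_RB and F_BR, as (graphs of) the recursively defined maps

mutual
  data FRB : Word → Forest → Set where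
    fRB : ∀ {w ws f} → IrrDecomp w ws → TRBs ws f → FRB w f

  data TRBs : List Word → Forest → Set where
    []  : TRBs [] []
    _∷_ : ∀ {w ws t f} → TRB w t → TRBs ws f → TRBs (w ∷ ws) (t ∷ f)

  data TRB : Word → Tree → Set where
    tRB : ∀ {w a b c fa fb} → RBFact w a b c → FRB a fa → FRB b fb →
          TRB w (node c fa fb)

mutual
  data FBR : Word → Forest → Set where
    fBR : ∀ {w ws f} → IrrDecomp w ws → TBRs (reverse ws) f → FBR w f

  data TBRs : List Word → Forest → Set where
    []  : TBRs [] []
    _∷_ : ∀ {w ws t f} → TBR w t → TBRs ws f → TBRs (w ∷ ws) (t ∷ f)

  data TBR : Word → Tree → Set where
    tBR : ∀ {w a b c fa fb} → BRFact w b a c → FBR b fb → FBR a fa →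
          TBR w (node c fb fa)

{-# OPTIONS --safe #-}
module Submission where

-- Both products have closed forms: u ◁_R v is u^[max v − 1] followed by v with its letters ≥ max v
-- raised by max u, and u ◁_B (v₀ · i) = v₀^[max u] · u · (i + max u).  They satisfy the interchange
-- law a ◁_R (b ◁_B c) = b ◁_B (a ◁_R c), so a red-blue factorization (a, b, c) of w yields a
-- blue-red candidate and conversely.  Comparing the maximal lengths of the left factors shows that
-- the blue-red factorization of w is (b, a, c) when c ≠ 1, while for c = 1 the word w ends with its
-- strict maximum and its blue-red factorization is (a, ε, 1).  These are the two clauses of the
-- mirror on a node, so induction on the length, with the uniqueness of the decomposition into
-- irreducibles, gives F_BR(w) = mirror of F_RB(w).

open import Defs
open import Data.Bool using (Bool; true; false)
open import Data.Empty using (⊥-elim)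
open import Data.List using (List; []; _∷_; [_]; _++_; map; length; take; drop; reverse)
open import Data.List.Properties
  using (∷-injective; ∷ʳ-injective; ++-assoc; ++-identityʳ; ++-conicalˡ; ++-conicalʳ; length-++; length-map;
         length-take; length-drop; map-++; map-injective; take++drop≡id; unfold-reverse; ≡-dec)
open import Data.List.Membership.Propositional using (_∈_; _∉_)
open import Data.List.Membership.Propositional.Properties using (∈-++⁺ˡ; ∈-++⁺ʳ; ∈-++⁻; ∈-map⁺; ∈-map⁻)
open import Data.List.Relation.Binary.Permutation.Propositional as ↭ using (_↭_; ↭-sym; ↭-reflexive)
open import Data.List.Relation.Binary.Permutation.Propositional.Properties using (∈-resp-↭; ++⁺ˡ; ++-comm)
open import Data.List.Relation.Unary.All as All using (All; []; _∷_)
open import Data.List.Relation.Unary.All.Properties using (++⁺)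
open import Data.List.Relation.Unary.Any using (here; there)
open import Data.Nat using (ℕ; zero; suc; _+_; _∸_; _⊔_; _≤_; _<_; _≟_; _≤?_; _<?_; z≤n; s≤s)
open import Data.Nat.Properties
open import Data.List.Membership.DecPropositional _≟_ using (_∈?_)
open import Data.Product using (Σ; ∃; _×_; _,_; proj₁; proj₂; map₁)
open import Data.Sum using (_⊎_; inj₁; inj₂)
open import Function using (_∘_)
open import Relation.Binary.Definitions using (Tri; tri<; tri≈; tri>)
open import Relation.Binary.PropositionalEquality
  using (_≡_; _≢_; refl; sym; trans; cong; cong₂; subst; subst₂; module ≡-Reasoning)
open import Relation.Nullary using (Dec; yes; no; ¬_)
open import Relation.Nullary.Decidable using (_×-dec_; _→-dec_; map′; ¬?)

open ≡-Reasoning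

variable
  A B : Set
  a b c u v w : Word

maxW-upper : ∀ {x w} → x ∈ w → x ≤ maxW w
maxW-upper {w = y ∷ w} (here refl) = m≤m⊔n y (maxW w)
maxW-upper {w = y ∷ w} (there p) = m≤n⇒m≤o⊔n y (maxW-upper p)

maxW-least : ∀ {n} w → (∀ {x} → x ∈ w → x ≤ n) → maxW w ≤ n
maxW-least [] f = z≤n
maxW-least (y ∷ w) f = ⊔-lub (f (here refl)) (maxW-least w (f ∘ there))

maxW-≡0⊎∈ : ∀ w → maxW w ≡ 0 ⊎ maxW w ∈ w
maxW-≡0⊎∈ [] = inj₁ refl
maxW-≡0⊎∈ (y ∷ w) with ⊔-sel y (maxW w) | maxW-≡0⊎∈ w
... | inj₁ e | _ = inj₂ (here e)
... | inj₂ e | inj₁ z = inj₁ (trans e z)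
... | inj₂ e | inj₂ p = inj₂ (there (subst (_∈ w) (sym e) p))

maxW-∈ : ∀ w → w ≢ [] → maxW w ∈ w
maxW-∈ [] w≢[] = ⊥-elim (w≢[] refl)
maxW-∈ (y ∷ w) _ with maxW-≡0⊎∈ (y ∷ w)
... | inj₂ p = p
... | inj₁ z = here (trans z (sym (n≤0⇒n≡0 (subst (y ≤_) z (m≤m⊔n y (maxW w))))))

maxW-≡ : ∀ {m w} → m ∈ w → (∀ {x} → x ∈ w → x ≤ m) → maxW w ≡ m
maxW-≡ {w = w} p f = ≤-antisym (maxW-least w f) (maxW-upper p)

maxW-++ : ∀ xs ys → maxW (xs ++ ys) ≡ maxW xs ⊔ maxW ys
maxW-++ [] ys = refl
maxW-++ (x ∷ xs) ys = trans (cong (x ⊔_) (maxW-++ xs ys)) (sym (⊔-assoc x (maxW xs) (maxW ys)))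

maxW-shift : ∀ k u → maxW (shift k u) ⊔ k ≡ k + maxW u
maxW-shift k [] = sym (+-identityʳ k)
maxW-shift k (x ∷ u) = begin
  ((k + x) ⊔ maxW (shift k u)) ⊔ k   ≡⟨ ⊔-assoc (k + x) _ k ⟩
  (k + x) ⊔ (maxW (shift k u) ⊔ k)   ≡⟨ cong ((k + x) ⊔_) (maxW-shift k u) ⟩
  (k + x) ⊔ (k + maxW u)             ≡⟨ sym (+-distribˡ-⊔ k x (maxW u)) ⟩
  k + (x ⊔ maxW u)                   ∎

maxW-⊙ : ∀ u v → maxW (u ⊙ v) ≡ maxW v + maxW u
maxW-⊙ u v = trans (maxW-++ (shift (maxW v) u) v) (maxW-shift (maxW v) u)

shift-zero : ∀ u → shift 0 u ≡ u
shift-zero [] = refl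
shift-zero (x ∷ u) = cong (x ∷_) (shift-zero u)

shift-+ : ∀ m k u → shift (m + k) u ≡ shift m (shift k u)
shift-+ m k [] = refl
shift-+ m k (x ∷ u) = cong₂ _∷_ (+-assoc m k x) (shift-+ m k u)

shift-injective : ∀ k {u u′} → shift k u ≡ shift k u′ → u ≡ u′
shift-injective k = map-injective (+-cancelˡ-≡ k _ _)

unshift : ∀ k u → map (_∸ k) (shift k u) ≡ u
unshift k [] = refl
unshift k (x ∷ u) = cong₂ _∷_ (m+n∸m≡n k x) (unshift k u)

shift-unshift : ∀ k u → (∀ {x} → x ∈ u → k < x) → shift k (map (_∸ k) u) ≡ u
shift-unshift k [] f = refl
shift-unshift k (x ∷ u) f = cong₂ _∷_ (m+[n∸m]≡n (<⇒≤ (f (here refl)))) (shift-unshift k u (f ∘ there))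

length-shift : ∀ k u → length (shift k u) ≡ length u
length-shift k u = length-map (k +_) u

length-⊙ : ∀ u v → length (u ⊙ v) ≡ length u + length v
length-⊙ u v = trans (length-++ (shift (maxW v) u)) (cong (_+ length v) (length-shift _ u))

⊙-assoc : ∀ u v t → (u ⊙ v) ⊙ t ≡ u ⊙ (v ⊙ t)
⊙-assoc u v t = begin
  shift mt (shift mv u ++ v) ++ t                 ≡⟨ cong (_++ t) (map-++ (mt +_) (shift mv u) v) ⟩
  (shift mt (shift mv u) ++ shift mt v) ++ t      ≡⟨ ++-assoc (shift mt (shift mv u)) _ t ⟩
  shift mt (shift mv u) ++ (shift mt v ++ t)      ≡⟨ cong (_++ (v ⊙ t)) (sym (shift-+ mt mv u)) ⟩
  shift (mt + mv) u ++ (v ⊙ t)                    ≡⟨ cong (λ m → shift m u ++ (v ⊙ t)) (sym (maxW-⊙ v t)) ⟩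
  u ⊙ (v ⊙ t)                                     ∎
  where
  mt = maxW t
  mv = maxW v

Packed-pos : Packed w → ∀ {x} → x ∈ w → 1 ≤ x
Packed-pos p = All.lookup (proj₁ p)

Packed-occ : Packed w → ∀ {i} → 1 ≤ i → i ≤ maxW w → i ∈ w
Packed-occ p = proj₂ p _

mkPacked : (∀ {x} → x ∈ w → 1 ≤ x) → (∀ {i} → 1 ≤ i → i ≤ maxW w → i ∈ w) → Packed w
mkPacked pos occ = All.tabulate pos , λ _ → occ

Packed-≈ : (∀ {x} → x ∈ u → x ∈ v) → (∀ {x} → x ∈ v → x ∈ u) → Packed u → Packed v
Packed-≈ {u} {v} u⊆v v⊆u p = mkPacked (Packed-pos p ∘ v⊆u)
  (λ i≥1 i≤ → u⊆v (Packed-occ p i≥1 (≤-trans i≤ (maxW-least v (maxW-upper ∘ v⊆u)))))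

Packed-↭ : u ↭ v → Packed u → Packed v
Packed-↭ p = Packed-≈ (∈-resp-↭ p) (∈-resp-↭ (↭-sym p))

Packed-maxW≥1 : Packed w → w ≢ [] → 1 ≤ maxW w
Packed-maxW≥1 {w} p w≢[] = Packed-pos p (maxW-∈ w w≢[])

Packed-[] : Packed []
Packed-[] = [] , λ { _ (s≤s _) () }

Packed-[1] : Packed [ 1 ]
Packed-[1] = (s≤s z≤n ∷ []) , λ { (suc zero) _ _ → here refl ; (suc (suc _)) _ (s≤s ()) }

Packed-[_]⇒≡1 : ∀ z → Packed [ z ] → z ≡ 1
Packed-[ z ]⇒≡1 p with Packed-occ p ≤-refl (subst (1 ≤_) (sym (⊔-identityʳ z)) (Packed-pos p (here refl)))
... | here e = sym e

++-cancel-length : ∀ (xs xs′ : List A) {ys ys′} →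
  length xs ≡ length xs′ → xs ++ ys ≡ xs′ ++ ys′ → xs ≡ xs′ × ys ≡ ys′
++-cancel-length [] [] _ e = refl , e
++-cancel-length (x ∷ xs) (x′ ∷ xs′) l e with ∷-injective e
... | refl , e′ with ++-cancel-length xs xs′ (suc-injective l) e′
...   | refl , e″ = refl , e″

++-suffix : ∀ (p s p′ s′ : List A) → p ++ s ≡ p′ ++ s′ → length s′ ≤ length s →
  Σ (List A) λ m → s ≡ m ++ s′ × p′ ≡ p ++ m
++-suffix [] s p′ s′ e _ = p′ , e , refl
++-suffix (x ∷ p) s [] s′ e l =
  ⊥-elim (<⇒≱ (s≤s (m≤n+m (length s) (length p))) (subst (_≤ length s) (trans (cong length (sym e)) (cong suc (length-++ p))) l))
++-suffix (x ∷ p) s (x′ ∷ p′) s′ e l with ∷-injective e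
... | refl , e′ with ++-suffix p s p′ s′ e′ l
...   | m , e₁ , e₂ = m , e₁ , cong (x ∷_) e₂

map-++⁻ : ∀ (f : A → B) xs ys zs → map f xs ≡ ys ++ zs →
  Σ (List A) λ xs₁ → Σ (List A) λ xs₂ → xs ≡ xs₁ ++ xs₂ × map f xs₁ ≡ ys × map f xs₂ ≡ zs
map-++⁻ f xs [] zs e = [] , xs , refl , refl , e
map-++⁻ f (x ∷ xs) (y ∷ ys) zs e with ∷-injective e
... | refl , e′ with map-++⁻ f xs ys zs e′
...   | xs₁ , xs₂ , refl , refl , refl = x ∷ xs₁ , xs₂ , refl , refl , refl

map-[]⁻ : ∀ (f : A → B) xs z → map f xs ≡ [ z ] → Σ A λ x → xs ≡ [ x ] × f x ≡ z
map-[]⁻ f (x ∷ []) z refl = x , refl , refl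

snocView : ∀ (xs : List A) → xs ≢ [] → Σ (List A) λ ys → Σ A λ z → xs ≡ ys ++ [ z ]
snocView [] xs≢[] = ⊥-elim (xs≢[] refl)
snocView (x ∷ []) _ = [] , x , refl
snocView (x ∷ y ∷ xs) _ with snocView (y ∷ xs) (λ ())
... | ys , z , e = x ∷ ys , z , cong (x ∷_) e

∷ʳ-≢[] : ∀ (xs : List A) z → xs ++ [ z ] ≢ []
∷ʳ-≢[] [] z ()
∷ʳ-≢[] (x ∷ xs) z ()

≢[]⇒length≥1 : ∀ (xs : List A) → xs ≢ [] → 1 ≤ length xs
≢[]⇒length≥1 [] xs≢[] = ⊥-elim (xs≢[] refl)
≢[]⇒length≥1 (_ ∷ _) _ = s≤s z≤n

length≡0⇒[] : ∀ (xs : List A) → length xs ≡ 0 → xs ≡ []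
length≡0⇒[] [] _ = refl

take-++-length : ∀ (xs ys : List A) → take (length xs) (xs ++ ys) ≡ xs
take-++-length [] ys = refl
take-++-length (x ∷ xs) ys = cong (x ∷_) (take-++-length xs ys)

drop-++-length : ∀ (xs ys : List A) → drop (length xs) (xs ++ ys) ≡ ys
drop-++-length [] ys = refl
drop-++-length (x ∷ xs) ys = drop-++-length xs ys

-- Splitting at a global descent

infix 4 _≺_
_≺_ : Word → Word → Set
xs ≺ ys = ∀ {x y} → x ∈ xs → y ∈ ys → x < y

module _ {P S : Word} (pk : Packed (P ++ S)) (S≺P : S ≺ P) where

  maxW-below : ∀ {p} → p ∈ P → maxW S < p
  maxW-below {p} p∈ with maxW-≡0⊎∈ S
  ... | inj₁ z = subst (_< p) (sym z) (Packed-pos pk (∈-++⁺ˡ p∈))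
  ... | inj₂ m∈ = S≺P m∈ p∈

  split-Packedʳ : Packed S
  split-Packedʳ = mkPacked (Packed-pos pk ∘ ∈-++⁺ʳ P) occ
    where
    occ : ∀ {i} → 1 ≤ i → i ≤ maxW S → i ∈ S
    occ {i} i≥1 i≤ with ∈-++⁻ P (Packed-occ pk i≥1 (≤-trans i≤ (maxW-least S (maxW-upper ∘ ∈-++⁺ʳ P))))
    ... | inj₂ q = q
    ... | inj₁ q = ⊥-elim (<⇒≱ (maxW-below q) i≤)

  split-Packedˡ : Packed (map (_∸ maxW S) P)
  split-Packedˡ = mkPacked pos occ
    where
    mS = maxW S
    pos : ∀ {x} → x ∈ map (_∸ mS) P → 1 ≤ x
    pos x∈ with ∈-map⁻ (_∸ mS) x∈
    ... | p , p∈ , refl = m<n⇒0<n∸m (maxW-below p∈)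
    occ : ∀ {i} → 1 ≤ i → i ≤ maxW (map (_∸ mS) P) → i ∈ map (_∸ mS) P
    occ {i} i≥1 i≤ with maxW-≡0⊎∈ (map (_∸ mS) P)
    ... | inj₁ z = ⊥-elim (<⇒≱ i≥1 (subst (i ≤_) z i≤))
    ... | inj₂ m∈ with ∈-map⁻ (_∸ mS) m∈
    ...   | p , p∈ , e with ∈-++⁻ P (Packed-occ pk (≤-trans i≥1 (m≤m+n i mS)) bound)
      where
      bound : i + mS ≤ maxW (P ++ S)
      bound = ≤-trans (+-monoˡ-≤ mS (subst (i ≤_) e i≤))
        (subst (_≤ maxW (P ++ S)) (sym (m∸n+n≡m (<⇒≤ (maxW-below p∈)))) (maxW-upper (∈-++⁺ˡ p∈)))
    ...     | inj₁ q = subst (_∈ map (_∸ mS) P) (m+n∸n≡m i mS) (∈-map⁺ (_∸ mS) q)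
    ...     | inj₂ q = ⊥-elim (<⇒≱ (+-monoˡ-≤ mS i≥1) (maxW-upper q))

  split-⊙ : P ++ S ≡ map (_∸ maxW S) P ⊙ S
  split-⊙ = cong (_++ S) (sym (shift-unshift (maxW S) P maxW-below))

-- Closed forms of u ◁_R v and of u ◁_B (v₀ · i)

raise : ℕ → ℕ → ℕ → ℕ
raise t d y with t ≤? y
... | yes _ = y + d
... | no  _ = y

raise-≥ : ∀ {t d y} → t ≤ y → raise t d y ≡ y + d
raise-≥ {t} {d} {y} t≤y with t ≤? y
... | yes _ = refl
... | no t≰y = ⊥-elim (t≰y t≤y)

raise-< : ∀ {t d y} → y < t → raise t d y ≡ y
raise-< {t} {d} {y} y<t with t ≤? y
... | yes t≤y = ⊥-elim (<⇒≱ y<t t≤y)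
... | no _ = refl

map-raise-< : ∀ {t d} xs → (∀ {x} → x ∈ xs → x < t) → map (raise t d) xs ≡ xs
map-raise-< [] f = refl
map-raise-< (x ∷ xs) f = cong₂ _∷_ (raise-< (f (here refl))) (map-raise-< xs (f ∘ there))

map-raise-zero : ∀ t xs → map (raise t 0) xs ≡ xs
map-raise-zero t [] = refl
map-raise-zero t (y ∷ xs) = cong₂ _∷_ (raise-zero (t ≤? y)) (map-raise-zero t xs)
  where
  raise-zero : Dec (t ≤ y) → raise t 0 y ≡ y
  raise-zero (yes t≤y) = trans (raise-≥ t≤y) (+-identityʳ y)
  raise-zero (no t≰y) = raise-< (≰⇒> t≰y)

raise-shift : ∀ s t d y → raise (s + t) d (s + y) ≡ s + raise t d y
raise-shift s t d y with t ≤? y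
... | yes t≤y = trans (raise-≥ (+-monoʳ-≤ s t≤y)) (+-assoc s y d)
... | no t≰y = raise-< (+-monoʳ-< s (≰⇒> t≰y))

map-raise-shift : ∀ s t d xs → map (raise (s + t) d) (shift s xs) ≡ shift s (map (raise t d) xs)
map-raise-shift s t d [] = refl
map-raise-shift s t d (x ∷ xs) = cong₂ _∷_ (raise-shift s t d x) (map-raise-shift s t d xs)

raise-inflationary : ∀ t d y → y ≤ raise t d y
raise-inflationary t d y with t ≤? y
... | yes _ = m≤m+n y d
... | no _ = ≤-refl

raise-≤ : ∀ t d y → y ≤ t → raise t d y ≤ t + d
raise-≤ t d y y≤t with t ≤? y
... | yes _ = +-monoˡ-≤ d y≤t
... | no _ = ≤-trans y≤t (m≤m+n t d)

raise-mono : ∀ t d {y y′} → y ≤ y′ → raise t d y ≤ raise t d y′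
raise-mono t d {y} {y′} y≤y′ with t ≤? y | t ≤? y′
... | yes _ | yes _ = +-monoˡ-≤ d y≤y′
... | yes t≤y | no t≰y′ = ⊥-elim (t≰y′ (≤-trans t≤y y≤y′))
... | no _ | yes _ = ≤-trans y≤y′ (m≤m+n y′ d)
... | no _ | no _ = y≤y′

raise-cancel-< : ∀ t d {y y′} → raise t d y < raise t d y′ → y < y′
raise-cancel-< t d {y} {y′} lt with y <? y′
... | yes y<y′ = y<y′
... | no y≮y′ = ⊥-elim (<⇒≱ lt (raise-mono t d (≮⇒≥ y≮y′)))

raise-mono-< : ∀ t d {y y′} → y < y′ → raise t d y < raise t d y′
raise-mono-< t d {y} {y′} y<y′ with t ≤? y | t ≤? y′
... | yes _ | yes _ = +-monoˡ-< d y<y′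
... | yes t≤y | no t≰y′ = ⊥-elim (t≰y′ (≤-trans t≤y (<⇒≤ y<y′)))
... | no _ | yes _ = <-≤-trans y<y′ (m≤m+n y′ d)
... | no _ | no _ = y<y′

raise-injective : ∀ t d {y y′} → raise t d y ≡ raise t d y′ → y ≡ y′
raise-injective t d {y} {y′} e with <-cmp y y′
... | tri< y<y′ _ _ = ⊥-elim (<⇒≢ (raise-mono-< t d y<y′) e)
... | tri≈ _ y≡y′ _ = y≡y′
... | tri> _ _ y′<y = ⊥-elim (<⇒≢ (raise-mono-< t d y′<y) (sym e))

redWord : Word → Word → Word
redWord u v = shift (maxW v ∸ 1) u ++ map (raise (maxW v) (maxW u)) v

blueWord : Word → Word → ℕ → Word
blueWord u v₀ i = shift (maxW u) v₀ ++ u ++ [ i + maxW u ]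

length-redWord : ∀ u v → length (redWord u v) ≡ length u + length v
length-redWord u v = trans (length-++ (shift (maxW v ∸ 1) u)) (cong₂ _+_ (length-shift _ u) (length-map _ v))

length-blueWord : ∀ u v₀ i → length (blueWord u v₀ i) ≡ length v₀ + (length u + 1)
length-blueWord u v₀ i = trans (length-++ (shift (maxW u) v₀)) (cong₂ _+_ (length-shift _ v₀) (length-++ u))

∈-place⁻ : ∀ {m x} I w → x ∈ place m I w → x ≡ m ⊎ x ∈ w
∈-place⁻ (true ∷ I) w (here e) = inj₁ e
∈-place⁻ (true ∷ I) w (there p) = ∈-place⁻ I w p
∈-place⁻ (false ∷ I) (y ∷ w) (here e) = inj₂ (here e)
∈-place⁻ (false ∷ I) (y ∷ w) (there p) with ∈-place⁻ I w p
... | inj₁ e = inj₁ e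
... | inj₂ q = inj₂ (there q)

trues≤length : ∀ I → trues I ≤ length I
trues≤length [] = z≤n
trues≤length (true ∷ I) = s≤s (trues≤length I)
trues≤length (false ∷ I) = m≤n⇒m≤1+n (trues≤length I)

∈-place-new : ∀ {m} I w → ValidMask I w → m ∈ place m I w
∈-place-new (true ∷ I) w _ = here refl
∈-place-new (false ∷ I) [] (e , _) = ⊥-elim (<⇒≱ (s≤s ≤-refl) (subst (_≤ length I) (sym e) (trues≤length I)))
∈-place-new (false ∷ I) (y ∷ w) (e , t≥1) = there (∈-place-new I w (suc-injective e , t≥1))

maxW-place : ∀ {m} I w → ValidMask I w → (∀ {x} → x ∈ w → x ≤ m) → maxW (place m I w) ≡ m
maxW-place {m} I w valid w≤m = maxW-≡ (∈-place-new I w valid) bound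
  where
  bound : ∀ {x} → x ∈ place m I w → x ≤ m
  bound x∈ with ∈-place⁻ I w x∈
  ... | inj₁ refl = ≤-refl
  ... | inj₂ q = w≤m q

map-place : ∀ (f : ℕ → ℕ) m I w → map f (place m I w) ≡ place (f m) I (map f w)
map-place f m [] w = refl
map-place f m (true ∷ I) w = cong (f m ∷_) (map-place f m I w)
map-place f m (false ∷ I) [] = refl
map-place f m (false ∷ I) (y ∷ w) = cong (f y ∷_) (map-place f m I w)

place-shiftMask : ∀ m I xs w → place m (shiftMask (length xs) I) (xs ++ w) ≡ xs ++ place m I w
place-shiftMask m I [] w = refl
place-shiftMask m I (x ∷ xs) w = cong (x ∷_) (place-shiftMask m I xs w)

φ-shiftMask-⊙ : ∀ u I v → ValidMask I v → φ (shiftMask (length u) I) (u ⊙ v) ≡ redWord u (φ I v)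
φ-shiftMask-⊙ u I v valid = begin
  place (suc (maxW (u ⊙ v))) (shiftMask (length u) I) (shift k u ++ v)
    ≡⟨ cong (λ n → place (suc n) (shiftMask (length u) I) (shift k u ++ v)) (maxW-⊙ u v) ⟩
  place (suc (k + mu)) (shiftMask (length u) I) (shift k u ++ v)
    ≡⟨ cong (λ n → place (suc (k + mu)) (shiftMask n I) (shift k u ++ v)) (sym (length-shift k u)) ⟩
  place (suc (k + mu)) (shiftMask (length (shift k u)) I) (shift k u ++ v)
    ≡⟨ place-shiftMask (suc (k + mu)) I (shift k u) v ⟩
  shift k u ++ place (suc (k + mu)) I v
    ≡⟨ cong₂ (λ n z → shift k u ++ place n I z) (sym (raise-≥ {suc k} {mu} ≤-refl))
             (sym (map-raise-< v (λ x∈ → s≤s (maxW-upper x∈)))) ⟩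
  shift k u ++ place (raise (suc k) mu (suc k)) I (map (raise (suc k) mu) v)
    ≡⟨ cong (shift k u ++_) (sym (map-place (raise (suc k) mu) (suc k) I v)) ⟩
  shift (suc k ∸ 1) u ++ map (raise (suc k) mu) (place (suc k) I v)
    ≡⟨ cong (λ n → shift (n ∸ 1) u ++ map (raise n mu) (place (suc k) I v))
            (sym (maxW-place I v valid (m≤n⇒m≤1+n ∘ maxW-upper))) ⟩
  redWord u (φ I v) ∎
  where
  k = maxW v
  mu = maxW u

RedProd⇒redWord : RedProd u v w → w ≡ redWord u v
RedProd⇒redWord {u} (I , v′ , _ , valid , refl , refl) = φ-shiftMask-⊙ u I v′ valid

removeAll : ℕ → Word → Word
removeAll m [] = []
removeAll m (y ∷ ys) with y ≟ m
... | yes _ = removeAll m ys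
... | no  _ = y ∷ removeAll m ys

positions : ℕ → Word → List Bool
positions m [] = []
positions m (y ∷ ys) with y ≟ m
... | yes _ = true ∷ positions m ys
... | no  _ = false ∷ positions m ys

place-positions : ∀ m v → place m (positions m v) (removeAll m v) ≡ v
place-positions m [] = refl
place-positions m (y ∷ ys) with y ≟ m
... | yes refl = cong (y ∷_) (place-positions m ys)
... | no  _ = cong (y ∷_) (place-positions m ys)

positions-valid : ∀ {m} v → m ∈ v → ValidMask (positions m v) (removeAll m v)
positions-valid {m} v m∈v = lengths v , trues≥1 v m∈v
  where
  lengths : ∀ v → length (positions m v) ≡ length (removeAll m v) + trues (positions m v)
  lengths [] = refl
  lengths (y ∷ ys) with y ≟ m
  ... | yes _ = trans (cong suc (lengths ys)) (sym (+-suc (length (removeAll m ys)) (trues (positions m ys))))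
  ... | no  _ = cong suc (lengths ys)
  trues≥1 : ∀ v → m ∈ v → 1 ≤ trues (positions m v)
  trues≥1 (y ∷ ys) m∈ with y ≟ m | m∈
  ... | yes _ | _ = s≤s z≤n
  ... | no y≢m | here refl = ⊥-elim (y≢m refl)
  ... | no _ | there p = trues≥1 ys p

∈-removeAll⁻ : ∀ {m x} v → x ∈ removeAll m v → x ∈ v × x ≢ m
∈-removeAll⁻ {m} (y ∷ ys) p with y ≟ m | p
... | yes _ | p′ = map₁ there (∈-removeAll⁻ ys p′)
... | no y≢m | here refl = here refl , y≢m
... | no _ | there p′ = map₁ there (∈-removeAll⁻ ys p′)

∈-removeAll⁺ : ∀ {m x} v → x ∈ v → x ≢ m → x ∈ removeAll m v
∈-removeAll⁺ {m} (y ∷ ys) p x≢m with y ≟ m | p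
... | yes refl | here refl = ⊥-elim (x≢m refl)
... | yes _ | there p′ = ∈-removeAll⁺ ys p′ x≢m
... | no _ | here refl = here refl
... | no _ | there p′ = there (∈-removeAll⁺ ys p′ x≢m)

removeMax : Word → Word
removeMax v = removeAll (maxW v) v

removeMax-< : ∀ v {x} → x ∈ removeMax v → x < maxW v
removeMax-< v x∈ with ∈-removeAll⁻ v x∈
... | x∈v , x≢m = ≤∧≢⇒< (maxW-upper x∈v) x≢m

maxW-removeMax : Packed v → maxW (removeMax v) ≡ maxW v ∸ 1
maxW-removeMax {v} pv =
  ≤-antisym (maxW-least _ (λ x∈ → ≤-pred (≤-trans (removeMax-< v x∈) (m≤n+m∸n (maxW v) 1)))) (lower (maxW v) refl)
  where
  lower : ∀ m → maxW v ≡ m → m ∸ 1 ≤ maxW (removeAll m v)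
  lower zero _ = z≤n
  lower (suc zero) _ = z≤n
  lower (suc (suc j)) e = maxW-upper (∈-removeAll⁺ v (Packed-occ pv (s≤s z≤n) (subst (suc j ≤_) (sym e) (n≤1+n (suc j)))) (λ ()))

Packed-removeMax : Packed v → Packed (removeMax v)
Packed-removeMax {v} pv = mkPacked (Packed-pos pv ∘ proj₁ ∘ ∈-removeAll⁻ v) occ
  where
  occ : ∀ {i} → 1 ≤ i → i ≤ maxW (removeMax v) → i ∈ removeMax v
  occ {i} i≥1 i≤ with maxW-≡0⊎∈ (removeMax v)
  ... | inj₁ z = ⊥-elim (<⇒≱ i≥1 (subst (i ≤_) z i≤))
  ... | inj₂ m∈ = ∈-removeAll⁺ v (Packed-occ pv i≥1 (<⇒≤ i<m)) (<⇒≢ i<m)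
    where i<m = ≤-<-trans i≤ (removeMax-< v m∈)

φ-removeMax : Packed v → v ≢ [] → φ (positions (maxW v) v) (removeMax v) ≡ v
φ-removeMax {v} pv v≢[] = begin
  place (suc (maxW (removeMax v))) I (removeMax v) ≡⟨ cong (λ n → place (suc n) I (removeMax v)) (maxW-removeMax pv) ⟩
  place (suc (maxW v ∸ 1)) I (removeMax v)         ≡⟨ cong (λ n → place n I (removeMax v)) (m+[n∸m]≡n (Packed-maxW≥1 pv v≢[])) ⟩
  place (maxW v) I (removeMax v)                   ≡⟨ place-positions (maxW v) v ⟩
  v                                                ∎
  where I = positions (maxW v) v

redWord-RedProd : ∀ u v → Packed v → v ≢ [] → RedProd u v (redWord u v)
redWord-RedProd u v pv v≢[] =
  I , removeMax v , Packed-removeMax pv , valid , sym (φ-removeMax pv v≢[]) ,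
  sym (trans (φ-shiftMask-⊙ u I (removeMax v) valid) (cong (redWord u) (φ-removeMax pv v≢[])))
  where
  I = positions (maxW v) v
  valid = positions-valid v (maxW-∈ v v≢[])

bump-≥ : ∀ {i x} → i ≤ x → bump i x ≡ suc x
bump-≥ {i} {x} i≤x with i ≤? x
... | yes _ = refl
... | no i≰x = ⊥-elim (i≰x i≤x)

bump-< : ∀ {i x} → x < i → bump i x ≡ x
bump-< {i} {x} x<i with i ≤? x
... | yes i≤x = ⊥-elim (<⇒≱ x<i i≤x)
... | no _ = refl

map-bump-< : ∀ i xs → (∀ {x} → x ∈ xs → x < i) → map (bump i) xs ≡ xs
map-bump-< i [] f = refl
map-bump-< i (x ∷ xs) f = cong₂ _∷_ (bump-< (f (here refl))) (map-bump-< i xs (f ∘ there))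

map-bump-shift : ∀ k i xs → map (bump (i + k)) (shift k xs) ≡ shift k (map (bump i) xs)
map-bump-shift k i [] = refl
map-bump-shift k i (x ∷ xs) = cong₂ _∷_ (bump-shift (i ≤? x)) (map-bump-shift k i xs)
  where
  bump-shift : Dec (i ≤ x) → bump (i + k) (k + x) ≡ k + bump i x
  bump-shift (yes i≤x) = begin
    bump (i + k) (k + x) ≡⟨ bump-≥ (subst (_≤ k + x) (+-comm k i) (+-monoʳ-≤ k i≤x)) ⟩
    suc (k + x)          ≡⟨ sym (+-suc k x) ⟩
    k + suc x            ≡⟨ cong (k +_) (sym (bump-≥ i≤x)) ⟩
    k + bump i x         ∎
  bump-shift (no i≰x) = trans (bump-< (subst (k + x <_) (+-comm k i) (+-monoʳ-< k (≰⇒> i≰x))))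
                              (cong (k +_) (sym (bump-< (≰⇒> i≰x))))

ψ○-⊙ : ∀ u v i → 1 ≤ i → ψ ○ (i + maxW u) (v ⊙ u) ≡ blueWord u (map (bump i) v) i
ψ○-⊙ u v i i≥1 = begin
  map (bump (i + mu)) (shift mu v ++ u) ++ [ i + mu ]
    ≡⟨ cong (_++ [ i + mu ]) (map-++ (bump (i + mu)) (shift mu v) u) ⟩
  (map (bump (i + mu)) (shift mu v) ++ map (bump (i + mu)) u) ++ [ i + mu ]
    ≡⟨ cong₂ (λ p q → (p ++ q) ++ [ i + mu ]) (map-bump-shift mu i v) (map-bump-< (i + mu) u u<i+mu) ⟩
  (shift mu (map (bump i) v) ++ u) ++ [ i + mu ]
    ≡⟨ ++-assoc (shift mu (map (bump i) v)) u [ i + mu ] ⟩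
  blueWord u (map (bump i) v) i ∎
  where
  mu = maxW u
  u<i+mu : ∀ {x} → x ∈ u → x < i + mu
  u<i+mu x∈ = <-≤-trans (s≤s (maxW-upper x∈)) (+-monoˡ-≤ mu i≥1)

BlueProd⇒blueWord : BlueProd u v w → Σ Word λ v₀ → Σ ℕ λ i → v ≡ v₀ ++ [ i ] × w ≡ blueWord u v₀ i
BlueProd⇒blueWord {u} (○ , i , v , _ , (i≥1 , _) , refl , refl) = map (bump i) v , i , refl , ψ○-⊙ u v i i≥1
BlueProd⇒blueWord {u} (● , i , v , _ , _ , refl , refl) = v , i , refl , ++-assoc (shift (maxW u) v) u [ i + maxW u ]

unbump : ℕ → ℕ → ℕ
unbump i x with i <? x
... | yes _ = x ∸ 1
... | no  _ = x

unbump-> : ∀ {i x} → i < x → unbump i x ≡ x ∸ 1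
unbump-> {i} {x} i<x with i <? x
... | yes _ = refl
... | no i≮x = ⊥-elim (i≮x i<x)

unbump-≤ : ∀ {i x} → x ≤ i → unbump i x ≡ x
unbump-≤ {i} {x} x≤i with i <? x
... | yes i<x = ⊥-elim (<⇒≱ i<x x≤i)
... | no _ = refl

bump-unbump : ∀ i xs → i ∉ xs → map (bump i) (map (unbump i) xs) ≡ xs
bump-unbump i [] _ = refl
bump-unbump i (x ∷ xs) i∉ = cong₂ _∷_ (inverse (<-cmp i x)) (bump-unbump i xs (i∉ ∘ there))
  where
  inverse : Tri (i < x) (i ≡ x) (x < i) → bump i (unbump i x) ≡ x
  inverse (tri< i<x _ _) = begin
    bump i (unbump i x) ≡⟨ cong (bump i) (unbump-> i<x) ⟩
    bump i (x ∸ 1)      ≡⟨ bump-≥ (≤-pred (≤-trans i<x (m≤n+m∸n x 1))) ⟩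
    suc (x ∸ 1)         ≡⟨ m+[n∸m]≡n (≤-trans (s≤s z≤n) i<x) ⟩
    x                   ∎
  inverse (tri≈ _ i≡x _) = ⊥-elim (i∉ (here i≡x))
  inverse (tri> _ _ x<i) = trans (cong (bump i) (unbump-≤ (<⇒≤ x<i))) (bump-< x<i)

module _ {v₀ : Word} {i : ℕ} (pk : Packed (v₀ ++ [ i ])) (i∉v₀ : i ∉ v₀) where

  private
    i∈ : i ∈ v₀ ++ [ i ]
    i∈ = ∈-++⁺ʳ v₀ (here refl)

    i≥1 : 1 ≤ i
    i≥1 = Packed-pos pk i∈

    ∈v₀ : ∀ {j} → j ∈ v₀ ++ [ i ] → j ≢ i → j ∈ v₀
    ∈v₀ p j≢i with ∈-++⁻ v₀ p
    ... | inj₁ q = q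
    ... | inj₂ (here e) = ⊥-elim (j≢i e)

    occ-below : ∀ {j} → 1 ≤ j → j < i → j ∈ v₀
    occ-below j≥1 j<i = ∈v₀ (Packed-occ pk j≥1 (≤-trans (<⇒≤ j<i) (maxW-upper i∈))) (<⇒≢ j<i)

  Packed-unbump : Packed (map (unbump i) v₀)
  Packed-unbump = mkPacked pos occ
    where
    pos : ∀ {x} → x ∈ map (unbump i) v₀ → 1 ≤ x
    pos x∈ with ∈-map⁻ (unbump i) x∈
    ... | x , x∈v₀ , refl = unbump-pos (Packed-pos pk (∈-++⁺ˡ x∈v₀))
      where
      unbump-pos : ∀ {x} → 1 ≤ x → 1 ≤ unbump i x
      unbump-pos {x} x≥1 with i <? x
      ... | yes i<x = ≤-trans i≥1 (∸-monoˡ-≤ 1 i<x)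
      ... | no _ = x≥1
    above : ∀ {j x} → i ≤ j → x ∈ v₀ → j ≤ unbump i x → suc j ≤ x
    above {j} {x} i≤j x∈v₀ j≤ with <-cmp i x
    ... | tri< i<x _ _ = ≤-trans (s≤s (subst (j ≤_) (unbump-> i<x) j≤)) (≤-reflexive (m+[n∸m]≡n (≤-trans (s≤s z≤n) i<x)))
    ... | tri≈ _ i≡x _ = ⊥-elim (i∉v₀ (subst (_∈ v₀) (sym i≡x) x∈v₀))
    ... | tri> _ _ x<i = ⊥-elim (<⇒≱ x<i (≤-trans i≤j (subst (j ≤_) (unbump-≤ (<⇒≤ x<i)) j≤)))
    occ : ∀ {j} → 1 ≤ j → j ≤ maxW (map (unbump i) v₀) → j ∈ map (unbump i) v₀
    occ {j} j≥1 j≤ with maxW-≡0⊎∈ (map (unbump i) v₀)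
    ... | inj₁ z = ⊥-elim (<⇒≱ j≥1 (subst (j ≤_) z j≤))
    ... | inj₂ m∈ with ∈-map⁻ (unbump i) m∈ | j <? i
    ...   | _ | yes j<i = subst (_∈ _) (unbump-≤ (<⇒≤ j<i)) (∈-map⁺ (unbump i) (occ-below j≥1 j<i))
    ...   | x , x∈v₀ , e | no j≮i = subst (_∈ _) (unbump-> (s≤s (≮⇒≥ j≮i))) (∈-map⁺ (unbump i) sj∈v₀)
      where
      sj≤x : suc j ≤ x
      sj≤x = above (≮⇒≥ j≮i) x∈v₀ (subst (j ≤_) e j≤)
      sj∈v₀ : suc j ∈ v₀
      sj∈v₀ = ∈v₀ (Packed-occ pk (s≤s z≤n) (≤-trans sj≤x (maxW-upper (∈-++⁺ˡ x∈v₀))))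
                  (λ sj≡i → <⇒≱ (s≤s (≮⇒≥ j≮i)) (≤-reflexive sj≡i))

  unbump-ValidIdx : ValidIdx ○ i (map (unbump i) v₀)
  unbump-ValidIdx = i≥1 , bound i refl
    where
    bound : ∀ n → i ≡ n → n ≤ suc (maxW (map (unbump i) v₀))
    bound zero _ = z≤n
    bound (suc zero) _ = s≤s z≤n
    bound (suc (suc k)) refl =
      s≤s (maxW-upper (subst (_∈ map (unbump i) v₀) (unbump-≤ (n≤1+n (suc k))) (∈-map⁺ (unbump i) (occ-below (s≤s z≤n) ≤-refl))))

blueWord-BlueProd : ∀ u v₀ i → Packed (v₀ ++ [ i ]) → BlueProd u (v₀ ++ [ i ]) (blueWord u v₀ i)
blueWord-BlueProd u v₀ i pk with i ∈? v₀
... | yes i∈v₀ = ● , i , v₀ , Packed-≈ v⊆v₀ ∈-++⁺ˡ pk ,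
                 (Packed-pos pk (∈-++⁺ʳ v₀ (here refl)) , maxW-upper i∈v₀) , refl ,
                 sym (++-assoc (shift (maxW u) v₀) u [ i + maxW u ])
  where
  v⊆v₀ : ∀ {x} → x ∈ v₀ ++ [ i ] → x ∈ v₀
  v⊆v₀ q with ∈-++⁻ v₀ q
  ... | inj₁ r = r
  ... | inj₂ (here refl) = i∈v₀
... | no i∉v₀ = ○ , i , map (unbump i) v₀ , Packed-unbump pk i∉v₀ , valid ,
                cong (_++ [ i ]) (sym (bump-unbump i v₀ i∉v₀)) ,
                sym (trans (ψ○-⊙ u (map (unbump i) v₀) i (proj₁ valid)) (cong (λ z → blueWord u z i) (bump-unbump i v₀ i∉v₀)))
  where valid = unbump-ValidIdx pk i∉v₀

blueWord-injective : ∀ {u v₀ i u′ v₀′ i′} → length u ≡ length u′ →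
  blueWord u v₀ i ≡ blueWord u′ v₀′ i′ → u ≡ u′ × v₀ ≡ v₀′ × i ≡ i′
blueWord-injective {u} {v₀} {i} {u′} {v₀′} {i′} lu e
  with ++-cancel-length (shift (maxW u) v₀) (shift (maxW u′) v₀′) lv e
  where
  lv : length (shift (maxW u) v₀) ≡ length (shift (maxW u′) v₀′)
  lv = trans (length-shift _ v₀) (trans (+-cancelʳ-≡ (length u + 1) _ _ (begin
    length v₀ + (length u + 1)   ≡⟨ sym (length-blueWord u v₀ i) ⟩
    length (blueWord u v₀ i)     ≡⟨ cong length e ⟩
    length (blueWord u′ v₀′ i′)  ≡⟨ length-blueWord u′ v₀′ i′ ⟩
    length v₀′ + (length u′ + 1) ≡⟨ cong (λ n → length v₀′ + (n + 1)) (sym lu) ⟩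
    length v₀′ + (length u + 1)  ∎)) (sym (length-shift _ v₀′)))
... | e₁ , e₂ with ∷ʳ-injective u u′ e₂
...   | refl , e₃ = refl , shift-injective (maxW u) e₁ , +-cancelʳ-≡ (maxW u) i i′ e₃

shift-amount-unique : ∀ {k k′ a a′} → Packed a → a ≢ [] → Packed a′ → a′ ≢ [] → shift k a ≡ shift k′ a′ → k ≡ k′
shift-amount-unique pa a≢[] pa′ a′≢[] e = ≤-antisym (≥ pa′ a′≢[] pa (sym e)) (≥ pa a≢[] pa′ e)
  where
  ≥ : ∀ {k k′ a a′} → Packed a → a ≢ [] → Packed a′ → shift k a ≡ shift k′ a′ → k′ ≤ k
  ≥ {k} {k′} pa a≢[] pa′ e
    with ∈-map⁻ (k′ +_) (subst (k + 1 ∈_) e (∈-map⁺ (k +_) (Packed-occ pa ≤-refl (Packed-maxW≥1 pa a≢[]))))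
  ... | y , y∈ , k+1≡k′+y = +-cancelʳ-≤ 1 k′ k (subst (k′ + 1 ≤_) (sym k+1≡k′+y) (+-monoʳ-≤ k′ (Packed-pos pa′ y∈)))

redWord-injective : ∀ {a c a′ c′} → Packed a → Packed a′ → Packed c → Packed c′ → c ≢ [] → c′ ≢ [] →
  length a ≡ length a′ → redWord a c ≡ redWord a′ c′ → a ≡ a′ × c ≡ c′
redWord-injective {[]} {c} {[]} {c′} _ _ _ _ _ _ _ e =
  refl , trans (sym (map-raise-zero (maxW c) c)) (trans e (map-raise-zero (maxW c′) c′))
redWord-injective {a@(_ ∷ _)} {c} {a′@(_ ∷ _)} {c′} pa pa′ pc pc′ c≢[] c′≢[] la e
  with ++-cancel-length (shift (maxW c ∸ 1) a) (shift (maxW c′ ∸ 1) a′)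
         (trans (length-shift _ a) (trans la (sym (length-shift _ a′)))) e
... | e₁ , e₂ = a≡a′ , c≡c′
  where
  k≡k′ : maxW c ∸ 1 ≡ maxW c′ ∸ 1
  k≡k′ = shift-amount-unique pa (λ ()) pa′ (λ ()) e₁
  a≡a′ : a ≡ a′
  a≡a′ = shift-injective (maxW c ∸ 1) (trans e₁ (cong (λ k → shift k a′) (sym k≡k′)))
  mc≡mc′ : maxW c ≡ maxW c′
  mc≡mc′ = begin
    maxW c             ≡⟨ sym (m+[n∸m]≡n (Packed-maxW≥1 pc c≢[])) ⟩
    suc (maxW c ∸ 1)   ≡⟨ cong suc k≡k′ ⟩
    suc (maxW c′ ∸ 1)  ≡⟨ m+[n∸m]≡n (Packed-maxW≥1 pc′ c′≢[]) ⟩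
    maxW c′            ∎
  c≡c′ : c ≡ c′
  c≡c′ = map-injective (raise-injective (maxW c) (maxW a))
           (trans e₂ (cong₂ (λ t d → map (raise t d) c′) (sym mc≡mc′) (cong maxW (sym a≡a′))))

redWord-Packed : Packed a → Packed c → c ≢ [] → Packed (redWord a c)
redWord-Packed {a} {c} pa pc c≢[] with m+[n∸m]≡n {1} {maxW c} (Packed-maxW≥1 pc c≢[])
... | mc≡1+k = mkPacked pos occ
  where
  k = maxW c ∸ 1
  ma = maxW a
  L = raise (maxW c) ma
  pos : ∀ {x} → x ∈ redWord a c → 1 ≤ x
  pos x∈ with ∈-++⁻ (shift k a) x∈
  ... | inj₁ q with ∈-map⁻ (k +_) q
  ...   | y , y∈ , refl = ≤-trans (Packed-pos pa y∈) (m≤n+m y k)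
  pos x∈ | inj₂ q with ∈-map⁻ L q
  ...   | y , y∈ , refl = ≤-trans (Packed-pos pc y∈) (raise-inflationary (maxW c) ma y)
  upper : ∀ {x} → x ∈ redWord a c → x ≤ maxW c + ma
  upper x∈ with ∈-++⁻ (shift k a) x∈
  ... | inj₁ q with ∈-map⁻ (k +_) q
  ...   | y , y∈ , refl = ≤-trans (+-monoʳ-≤ k (maxW-upper y∈)) (+-monoˡ-≤ ma (m∸n≤m (maxW c) 1))
  upper x∈ | inj₂ q with ∈-map⁻ L q
  ...   | y , y∈ , refl = raise-≤ (maxW c) ma y (maxW-upper y∈)
  occ : ∀ {j} → 1 ≤ j → j ≤ maxW (redWord a c) → j ∈ redWord a c
  occ {j} j≥1 j≤ with ≤-trans j≤ (maxW-least (redWord a c) upper) | j ≤? k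
  ... | _ | yes j≤k = ∈-++⁺ʳ (shift k a)
          (subst (_∈ map L c) (raise-< (subst (j <_) mc≡1+k (s≤s j≤k)))
            (∈-map⁺ L (Packed-occ pc j≥1 (subst (j ≤_) mc≡1+k (m≤n⇒m≤1+n j≤k)))))
  ... | j≤top | no j≰k with (j ∸ k) ≤? ma
  ...   | yes j∸k≤ma = ∈-++⁺ˡ (subst (_∈ shift k a) (m+[n∸m]≡n (<⇒≤ (≰⇒> j≰k)))
                          (∈-map⁺ (k +_) (Packed-occ pa (m<n⇒0<n∸m (≰⇒> j≰k)) j∸k≤ma)))
  ...   | no j∸k≰ma = ∈-++⁺ʳ (shift k a) (subst (_∈ map L c) L-top (∈-map⁺ L (maxW-∈ c c≢[])))
    where
    top≤j : maxW c + ma ≤ j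
    top≤j = ≤-trans (≤-reflexive (trans (cong (_+ ma) (sym mc≡1+k)) (sym (+-suc k ma))))
                    (subst (k + suc ma ≤_) (m+[n∸m]≡n (<⇒≤ (≰⇒> j≰k))) (+-monoʳ-≤ k (≰⇒> j∸k≰ma)))
    L-top : L (maxW c) ≡ j
    L-top = trans (raise-≥ {maxW c} {ma} ≤-refl) (≤-antisym top≤j j≤top)

blueWord-Packed : ∀ b c₀ i → Packed b → Packed (c₀ ++ [ i ]) → Packed (blueWord b c₀ i)
blueWord-Packed b c₀ i pb pc = mkPacked pos occ
  where
  mb = maxW b
  i∈ : i ∈ c₀ ++ [ i ]
  i∈ = ∈-++⁺ʳ c₀ (here refl)
  pos : ∀ {x} → x ∈ blueWord b c₀ i → 1 ≤ x
  pos x∈ with ∈-++⁻ (shift mb c₀) x∈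
  ... | inj₁ q with ∈-map⁻ (mb +_) q
  ...   | y , y∈ , refl = ≤-trans (Packed-pos pc (∈-++⁺ˡ y∈)) (m≤n+m y mb)
  pos x∈ | inj₂ q with ∈-++⁻ b q
  ...   | inj₁ r = Packed-pos pb r
  ...   | inj₂ (here refl) = ≤-trans (Packed-pos pc i∈) (m≤m+n i mb)
  maxW-blueWord : maxW (blueWord b c₀ i) ≤ mb + maxW (c₀ ++ [ i ])
  maxW-blueWord = maxW-least (blueWord b c₀ i) upper
    where
    upper : ∀ {x} → x ∈ blueWord b c₀ i → x ≤ mb + maxW (c₀ ++ [ i ])
    upper x∈ with ∈-++⁻ (shift mb c₀) x∈
    ... | inj₁ q with ∈-map⁻ (mb +_) q
    ...   | y , y∈ , refl = +-monoʳ-≤ mb (maxW-upper (∈-++⁺ˡ y∈))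
    upper x∈ | inj₂ q with ∈-++⁻ b q
    ...   | inj₁ r = ≤-trans (maxW-upper r) (m≤m+n mb _)
    ...   | inj₂ (here refl) = subst (_≤ mb + maxW (c₀ ++ [ i ])) (+-comm mb i) (+-monoʳ-≤ mb (maxW-upper i∈))
  occ : ∀ {j} → 1 ≤ j → j ≤ maxW (blueWord b c₀ i) → j ∈ blueWord b c₀ i
  occ {j} j≥1 j≤ with j ≤? mb
  ... | yes j≤mb = ∈-++⁺ʳ (shift mb c₀) (∈-++⁺ˡ (Packed-occ pb j≥1 j≤mb))
  ... | no j≰mb with ∈-++⁻ c₀ (Packed-occ pc (m<n⇒0<n∸m (≰⇒> j≰mb)) j∸mb≤)
    where
    j∸mb≤ : j ∸ mb ≤ maxW (c₀ ++ [ i ])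
    j∸mb≤ = +-cancelˡ-≤ mb _ _ (subst (_≤ mb + _) (sym (m+[n∸m]≡n (<⇒≤ (≰⇒> j≰mb)))) (≤-trans j≤ maxW-blueWord))
  ...   | inj₁ q = ∈-++⁺ˡ (subst (_∈ shift mb c₀) (m+[n∸m]≡n (<⇒≤ (≰⇒> j≰mb))) (∈-map⁺ (mb +_) q))
  ...   | inj₂ (here e) = ∈-++⁺ʳ (shift mb c₀) (∈-++⁺ʳ b (here (begin
    j                ≡⟨ sym (m+[n∸m]≡n (<⇒≤ (≰⇒> j≰mb))) ⟩
    mb + (j ∸ mb)    ≡⟨ cong (mb +_) e ⟩
    mb + i           ≡⟨ +-comm mb i ⟩
    i + mb           ∎)))

split-blueWord : ∀ P S ℓ → Packed (P ++ S ++ [ ℓ ]) → S ≺ P ++ [ ℓ ] →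
  Packed S × Packed (map (_∸ maxW S) P ++ [ ℓ ∸ maxW S ]) ×
  P ++ S ++ [ ℓ ] ≡ blueWord S (map (_∸ maxW S) P) (ℓ ∸ maxW S)
split-blueWord P S ℓ pk S≺ =
  split-Packedʳ pk′ S≺ , subst Packed (map-++ (_∸ maxW S) P [ ℓ ]) (split-Packedˡ pk′ S≺) ,
  sym (cong₂ (λ p q → p ++ S ++ [ q ]) (shift-unshift (maxW S) P (below ∘ ∈-++⁺ˡ))
                                       (m∸n+n≡m (<⇒≤ (below (∈-++⁺ʳ P (here refl))))))
  where
  pk′ : Packed ((P ++ [ ℓ ]) ++ S)
  pk′ = Packed-↭ (↭.trans (++⁺ˡ P (++-comm S [ ℓ ])) (↭-reflexive (sym (++-assoc P [ ℓ ] S)))) pk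
  below : ∀ {p} → p ∈ P ++ [ ℓ ] → maxW S < p
  below = maxW-below pk′ S≺

split-BlueProd : ∀ P S ℓ → Packed (P ++ S ++ [ ℓ ]) → S ≺ P ++ [ ℓ ] →
  Σ Word λ v → Packed S × Packed v × v ≢ [] × BlueProd S v (P ++ S ++ [ ℓ ])
split-BlueProd P S ℓ pk S≺ with split-blueWord P S ℓ pk S≺
... | pS , pv , e = _ , pS , pv , ∷ʳ-≢[] _ _ , subst (BlueProd S _) (sym e) (blueWord-BlueProd S _ _ pv)

blueWord-left≺ : ∀ b y₀ i → Packed (y₀ ++ [ i ]) → b ≺ shift (maxW b) y₀ ++ [ i + maxW b ]
blueWord-left≺ b y₀ i pk {s} s∈ p∈ with ∈-++⁻ (shift (maxW b) y₀) p∈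
... | inj₁ q with ∈-map⁻ (maxW b +_) q
...   | z , z∈ , refl = <-≤-trans (s≤s (maxW-upper s∈))
                          (subst (_≤ maxW b + z) (+-comm (maxW b) 1) (+-monoʳ-≤ (maxW b) (Packed-pos pk (∈-++⁺ˡ z∈))))
blueWord-left≺ b y₀ i pk {s} s∈ p∈ | inj₂ (here refl) =
  <-≤-trans (s≤s (maxW-upper s∈)) (+-monoˡ-≤ (maxW b) (Packed-pos pk (∈-++⁺ʳ y₀ (here refl))))

-- The interchange law

maxW-blueWord : ∀ b c₀ i → maxW (blueWord b c₀ i) ≡ maxW b + maxW (c₀ ++ [ i ])
maxW-blueWord b c₀ i = begin
  maxW (shift mb c₀ ++ b ++ [ i + mb ])   ≡⟨ maxW-++ (shift mb c₀) (b ++ [ i + mb ]) ⟩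
  M₀ ⊔ maxW (b ++ [ i + mb ])             ≡⟨ cong (M₀ ⊔_) (maxW-++ b [ i + mb ]) ⟩
  M₀ ⊔ (mb ⊔ ((i + mb) ⊔ 0))              ≡⟨ cong (λ z → M₀ ⊔ (mb ⊔ z)) (⊔-identityʳ (i + mb)) ⟩
  M₀ ⊔ (mb ⊔ (i + mb))                    ≡⟨ sym (⊔-assoc M₀ mb (i + mb)) ⟩
  (M₀ ⊔ mb) ⊔ (i + mb)                    ≡⟨ cong₂ _⊔_ (maxW-shift mb c₀) (+-comm i mb) ⟩
  (mb + maxW c₀) ⊔ (mb + i)               ≡⟨ sym (+-distribˡ-⊔ mb (maxW c₀) i) ⟩
  mb + (maxW c₀ ⊔ i)                      ≡⟨ cong (λ z → mb + (maxW c₀ ⊔ z)) (sym (⊔-identityʳ i)) ⟩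
  mb + (maxW c₀ ⊔ (i ⊔ 0))                ≡⟨ cong (mb +_) (sym (maxW-++ c₀ [ i ])) ⟩
  mb + maxW (c₀ ++ [ i ])                 ∎
  where
  mb = maxW b
  M₀ = maxW (shift mb c₀)

redWord-∷ʳ : ∀ a c₀ i k → maxW (c₀ ++ [ i ]) ≡ suc k →
  redWord a (c₀ ++ [ i ]) ≡ (shift k a ++ map (raise (suc k) (maxW a)) c₀) ++ [ raise (suc k) (maxW a) i ]
redWord-∷ʳ a c₀ i k mc = begin
  shift (maxW (c₀ ++ [ i ]) ∸ 1) a ++ map (raise (maxW (c₀ ++ [ i ])) (maxW a)) (c₀ ++ [ i ])
    ≡⟨ cong (λ m → shift (m ∸ 1) a ++ map (raise m (maxW a)) (c₀ ++ [ i ])) mc ⟩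
  shift k a ++ map L (c₀ ++ [ i ])       ≡⟨ cong (shift k a ++_) (map-++ L c₀ [ i ]) ⟩
  shift k a ++ (map L c₀ ++ [ L i ])     ≡⟨ sym (++-assoc (shift k a) _ _) ⟩
  (shift k a ++ map L c₀) ++ [ L i ]     ∎
  where L = raise (suc k) (maxW a)

redWord-blueWord : ∀ a b c₀ i k → maxW (c₀ ++ [ i ]) ≡ suc k →
  redWord a (blueWord b c₀ i) ≡ blueWord b (shift k a ++ map (raise (suc k) (maxW a)) c₀) (raise (suc k) (maxW a) i)
redWord-blueWord a b c₀ i k mc = begin
  redWord a x                                     ≡⟨ cong (λ m → shift (m ∸ 1) a ++ map (raise m ma) x) mx ⟩
  shift (mb + suc k ∸ 1) a ++ map L′ x            ≡⟨ cong (λ m → shift (m ∸ 1) a ++ map L′ x) (+-suc mb k) ⟩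
  shift (mb + k) a ++ map L′ x                    ≡⟨ cong (_++ map L′ x) (shift-+ mb k a) ⟩
  shift mb (shift k a) ++ map L′ x                ≡⟨ cong (shift mb (shift k a) ++_) L′x ⟩
  shift mb (shift k a) ++ (shift mb (map L c₀) ++ b ++ [ L i + mb ])
    ≡⟨ sym (++-assoc (shift mb (shift k a)) _ _) ⟩
  (shift mb (shift k a) ++ shift mb (map L c₀)) ++ b ++ [ L i + mb ]
    ≡⟨ cong (_++ b ++ [ L i + mb ]) (sym (map-++ (mb +_) (shift k a) (map L c₀))) ⟩
  blueWord b (shift k a ++ map L c₀) (L i) ∎
  where
  x = blueWord b c₀ i
  ma = maxW a
  mb = maxW b
  L = raise (suc k) ma
  L′ = raise (mb + suc k) ma
  mx : maxW x ≡ mb + suc k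
  mx = trans (maxW-blueWord b c₀ i) (cong (mb +_) mc)
  b<mb+1+k : ∀ {y} → y ∈ b → y < mb + suc k
  b<mb+1+k y∈ = ≤-trans (s≤s (maxW-upper y∈)) (subst (suc mb ≤_) (sym (+-suc mb k)) (s≤s (m≤m+n mb k)))
  L′x : map L′ x ≡ shift mb (map L c₀) ++ b ++ [ L i + mb ]
  L′x = begin
    map L′ (shift mb c₀ ++ b ++ [ i + mb ])        ≡⟨ map-++ L′ (shift mb c₀) (b ++ [ i + mb ]) ⟩
    map L′ (shift mb c₀) ++ map L′ (b ++ [ i + mb ]) ≡⟨ cong (map L′ (shift mb c₀) ++_) (map-++ L′ b [ i + mb ]) ⟩
    map L′ (shift mb c₀) ++ map L′ b ++ [ L′ (i + mb) ]
      ≡⟨ cong₂ (λ p q → p ++ q ++ [ L′ (i + mb) ]) (map-raise-shift mb (suc k) ma c₀) (map-raise-< b b<mb+1+k) ⟩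
    shift mb (map L c₀) ++ b ++ [ L′ (i + mb) ]
      ≡⟨ cong (λ z → shift mb (map L c₀) ++ b ++ [ z ])
              (trans (cong L′ (+-comm i mb)) (trans (raise-shift mb (suc k) ma i) (+-comm mb (L i)))) ⟩
    shift mb (map L c₀) ++ b ++ [ L i + mb ] ∎

interchange : ∀ a b {c₀ i z j} → 1 ≤ maxW (c₀ ++ [ i ]) → redWord a (c₀ ++ [ i ]) ≡ z ++ [ j ] →
  redWord a (blueWord b c₀ i) ≡ blueWord b z j
interchange a b {c₀} {i} c≥1 e
  with ∷ʳ-injective _ _ (trans (sym e) (redWord-∷ʳ a c₀ i _ (sym (m+[n∸m]≡n c≥1))))
... | refl , refl = redWord-blueWord a b c₀ i _ (sym (m+[n∸m]≡n c≥1))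

redWord-≢[] : ∀ a c → c ≢ [] → redWord a c ≢ []
redWord-≢[] a c c≢[] e = c≢[] (length≡0⇒[] c (m+n≡0⇒n≡0 (length a) (trans (sym (length-redWord a c)) (cong length e))))

blueWord-≢[] : ∀ b c₀ i → blueWord b c₀ i ≢ []
blueWord-≢[] b c₀ i = ∷ʳ-≢[] b _ ∘ ++-conicalʳ (shift (maxW b) c₀) _

redBlue⇒blueRed : ∀ {x} → Packed a → Packed c → c ≢ [] → RedProd a x w → BlueProd b c x →
  Σ Word λ y → Packed y × y ≢ [] × BlueProd b y w × RedProd a c y
redBlue⇒blueRed {a} {c} {b = b} pa pc c≢[] rp bp with BlueProd⇒blueWord bp | RedProd⇒redWord rp
... | c₀ , i , refl , refl | refl with snocView (redWord a c) (redWord-≢[] a c c≢[])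
...   | z , j , e = redWord a c , redWord-Packed pa pc c≢[] , subst (_≢ []) (sym e) (∷ʳ-≢[] z j) ,
                    subst₂ (BlueProd b) (sym e) (sym (interchange a b (Packed-maxW≥1 pc c≢[]) e))
                      (blueWord-BlueProd b z j (subst Packed e (redWord-Packed pa pc c≢[]))) ,
                    redWord-RedProd a c pc c≢[]

blueRed⇒redBlue : ∀ {y} → Packed b → Packed c → c ≢ [] → BlueProd b y w → RedProd a c y →
  Σ Word λ x → Packed x × x ≢ [] × RedProd a x w × BlueProd b c x
blueRed⇒redBlue {b} {c} {a = a} pb pc c≢[] bp rp with BlueProd⇒blueWord bp | RedProd⇒redWord rp | snocView c c≢[]
... | y₀ , j , refl , refl | e | c₀ , i , refl =
  x , blueWord-Packed b c₀ i pb pc , blueWord-≢[] b c₀ i ,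
  subst (RedProd a x) (interchange a b (Packed-maxW≥1 pc c≢[]) (sym e))
    (redWord-RedProd a x (blueWord-Packed b c₀ i pb pc) (blueWord-≢[] b c₀ i)) ,
  blueWord-BlueProd b c₀ i pc
  where x = blueWord b c₀ i

-- Comparing the red-blue and blue-red factorizations

RedProd-length : RedProd u v w → length w ≡ length u + length v
RedProd-length {u} {v} rp = trans (cong length (RedProd⇒redWord rp)) (length-redWord u v)

BlueProd-length : BlueProd u v w → length w ≡ length v + length u
BlueProd-length {u} bp with BlueProd⇒blueWord bp
... | v₀ , i , refl , refl = begin
  length (blueWord u v₀ i)       ≡⟨ length-blueWord u v₀ i ⟩
  length v₀ + (length u + 1)     ≡⟨ cong (length v₀ +_) (+-comm (length u) 1) ⟩
  length v₀ + (1 + length u)     ≡⟨ sym (+-assoc (length v₀) 1 (length u)) ⟩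
  (length v₀ + 1) + length u     ≡⟨ cong (_+ length u) (sym (length-++ v₀)) ⟩
  length (v₀ ++ [ i ]) + length u ∎

factor-lengths : ∀ {u v w : Word} → length w ≡ length u + length v → v ≢ [] → length u < length w × length v ≤ length w
factor-lengths {u} {v} lw v≢[] =
  subst (length u <_) (sym lw) (subst (_≤ length u + length v) (+-comm (length u) 1) (+-monoʳ-≤ (length u) (≢[]⇒length≥1 v v≢[]))) ,
  subst (length v ≤_) (sym lw) (m≤n+m (length v) (length u))

redFact-lengths : IsRedFact w u v → length u < length w × length v ≤ length w
redFact-lengths {w} {u} {v} (_ , _ , v≢[] , rp , _) = factor-lengths {u} {v} {w} (RedProd-length rp) v≢[]

blueFact-lengths : IsBlueFact w u v → length u < length w × length v ≤ length w
blueFact-lengths {w} {u} {v} (_ , _ , v≢[] , bp , _) =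
  factor-lengths {u} {v} {w} (trans (BlueProd-length bp) (+-comm (length v) (length u))) v≢[]

RedProd-unique : ∀ {u v u′ v′} → Packed u → Packed v → v ≢ [] → Packed u′ → Packed v′ → v′ ≢ [] →
  RedProd u v w → RedProd u′ v′ w → length u ≡ length u′ → u ≡ u′ × v ≡ v′
RedProd-unique pu pv v≢[] pu′ pv′ v′≢[] rp rp′ l =
  redWord-injective pu pu′ pv pv′ v≢[] v′≢[] l (trans (sym (RedProd⇒redWord rp)) (RedProd⇒redWord rp′))

BlueProd-unique : ∀ {u v u′ v′} → BlueProd u v w → BlueProd u′ v′ w → length u ≡ length u′ → u ≡ u′ × v ≡ v′
BlueProd-unique {w} {u} {v} {u′} {v′} bp bp′ l with BlueProd⇒blueWord bp | BlueProd⇒blueWord bp′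
... | v₀ , i , refl , e | v₀′ , i′ , refl , e′ with blueWord-injective {u} {v₀} {i} {u′} {v₀′} {i′} l (trans (sym e) e′)
...   | refl , refl , refl = refl , refl

redFact-unique : ∀ {u v u′ v′} → IsRedFact w u v → RedProd u′ v′ w → Packed u′ → Packed v′ → v′ ≢ [] →
  length u ≤ length u′ → u ≡ u′ × v ≡ v′
redFact-unique (pu , pv , v≢[] , rp , maximal) rp′ pu′ pv′ v′≢[] l =
  RedProd-unique pu pv v≢[] pu′ pv′ v′≢[] rp rp′ (≤-antisym l (maximal _ _ pu′ pv′ v′≢[] rp′))

blueFact-unique : ∀ {u v u′ v′} → IsBlueFact w u v → BlueProd u′ v′ w → Packed u′ → Packed v′ → v′ ≢ [] →
  length u ≤ length u′ → u ≡ u′ × v ≡ v′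
blueFact-unique (_ , _ , _ , bp , maximal) bp′ pu′ pv′ v′≢[] l =
  BlueProd-unique bp bp′ (≤-antisym l (maximal _ _ pu′ pv′ v′≢[] bp′))

-- addTop u is both u ◁_R 1 and u ◁_B 1.
addTop : Word → Word
addTop u = u ++ [ suc (maxW u) ]

maxW-addTop : ∀ u → maxW (addTop u) ≡ suc (maxW u)
maxW-addTop u = begin
  maxW (u ++ [ suc (maxW u) ])    ≡⟨ maxW-++ u [ suc (maxW u) ] ⟩
  maxW u ⊔ (suc (maxW u) ⊔ 0)     ≡⟨ cong (maxW u ⊔_) (⊔-identityʳ (suc (maxW u))) ⟩
  maxW u ⊔ suc (maxW u)           ≡⟨ m≤n⇒m⊔n≡n (n≤1+n (maxW u)) ⟩
  suc (maxW u)                    ∎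

∸≡1⇒≡suc : ∀ m n → m ∸ n ≡ 1 → m ≡ suc n
∸≡1⇒≡suc (suc zero) zero _ = refl
∸≡1⇒≡suc (suc m) (suc n) e = cong suc (∸≡1⇒≡suc m n e)

≺-last⇒addTop : ∀ {e} → Packed (u ++ [ e ]) → u ≺ [ e ] → Packed u × u ++ [ e ] ≡ addTop u
≺-last⇒addTop {u} {e} pk u≺e with split-blueWord [] u e pk u≺e
... | pu , p[e∸m] , _ = pu , cong (λ n → u ++ [ n ]) (∸≡1⇒≡suc e (maxW u) (Packed-[ e ∸ maxW u ]⇒≡1 p[e∸m]))

addTop-Packed⁻ : Packed (addTop u) → Packed u
addTop-Packed⁻ {u} pk = proj₁ (≺-last⇒addTop pk u≺top)
  where
  u≺top : u ≺ [ suc (maxW u) ]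
  u≺top x∈ (here refl) = s≤s (maxW-upper x∈)

redWord-[1] : ∀ u → redWord u [ 1 ] ≡ addTop u
redWord-[1] u = cong₂ (λ p n → p ++ [ n ]) (shift-zero u) (raise-≥ {1} {maxW u} ≤-refl)

redFact-addTop : Packed w → w ≡ addTop u → IsRedFact w a v → a ≡ u × v ≡ [ 1 ]
redFact-addTop {w} {u} pw refl f =
  redFact-unique f (subst (RedProd u [ 1 ]) (redWord-[1] u) (redWord-RedProd u [ 1 ] Packed-[1] (λ ())))
    (addTop-Packed⁻ pw) Packed-[1] (λ ())
    (≤-pred (subst (_ <_) (trans (length-++ u) (+-comm (length u) 1)) (proj₁ (redFact-lengths f))))

blueFact-addTop : Packed w → w ≡ addTop u → IsBlueFact w a v → a ≡ u × v ≡ [ 1 ]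
blueFact-addTop {w} {u} pw refl f =
  blueFact-unique f (blueWord-BlueProd u [] 1 Packed-[1]) (addTop-Packed⁻ pw) Packed-[1] (λ ())
    (≤-pred (subst (_ <_) (trans (length-++ u) (+-comm (length u) 1)) (proj₁ (blueFact-lengths f))))

BlueProd-[1] : BlueProd b [ 1 ] w → w ≡ addTop b
BlueProd-[1] bp with BlueProd⇒blueWord bp
... | c₀ , i , e , refl with ∷ʳ-injective [] c₀ e
...   | refl , refl = refl

redWord-addTop : ∀ a b → redWord a (addTop b) ≡ addTop (a ⊙ b)
redWord-addTop a b = begin
  redWord a (b ++ [ suc mb ])                ≡⟨ redWord-∷ʳ a b (suc mb) mb (maxW-addTop b) ⟩
  (shift mb a ++ map L b) ++ [ L (suc mb) ]
    ≡⟨ cong₂ (λ p n → (shift mb a ++ p) ++ [ n ]) (map-raise-< b (s≤s ∘ maxW-upper)) (raise-≥ {suc mb} ≤-refl) ⟩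
  (a ⊙ b) ++ [ suc (mb + maxW a) ]           ≡⟨ cong (λ n → (a ⊙ b) ++ [ suc n ]) (sym (maxW-⊙ a b)) ⟩
  addTop (a ⊙ b)                             ∎
  where
  mb = maxW b
  L = raise (suc mb) (maxW a)

-- Here w = a ◁_R x = b′ ◁_B (y₀ · iy).  Raising is order-preserving, so the order between b′ and the
-- letters following it in w transfers to the letters of x that b′ overlaps.
module _ {a x b′ y₀ : Word} {iy : ℕ} (py : Packed (y₀ ++ [ iy ])) (E : redWord a x ≡ blueWord b′ y₀ iy) where

  private
    mx = maxW x
    L = raise mx (maxW a)
    ℓ = iy + maxW b′

    b′≺ : b′ ≺ shift (maxW b′) y₀ ++ [ ℓ ]
    b′≺ = blueWord-left≺ b′ y₀ iy py

  blueLeft-inside-redRight : Packed x → length b′ < length x →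
    Σ Word λ v → Packed b′ × Packed v × v ≢ [] × BlueProd b′ v x
  blueLeft-inside-redRight px b′<x
    with ++-suffix (shift (mx ∸ 1) a) (map L x) (shift (maxW b′) y₀) (b′ ++ [ ℓ ]) E
           (subst₂ _≤_ (sym (trans (length-++ b′) (+-comm (length b′) 1))) (sym (length-map L x)) b′<x)
  ... | M , Lx≡ , y₀≡ with map-++⁻ L x M (b′ ++ [ ℓ ]) Lx≡
  ...   | P , R , refl , refl , LR≡ with map-++⁻ L R b′ [ ℓ ] LR≡
  ...     | S , T , refl , LS≡b′ , LT≡ with map-[]⁻ L T ℓ LT≡
  ...       | e , refl , Le≡ℓ =
    subst (λ s → Σ Word λ v → Packed s × Packed v × v ≢ [] × BlueProd s v x) S≡b′ (split-BlueProd P S e px S≺)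
    where
    Lp∈ : ∀ {p} → p ∈ P ++ [ e ] → L p ∈ shift (maxW b′) y₀ ++ [ ℓ ]
    Lp∈ p∈ with ∈-++⁻ P p∈
    ... | inj₁ q = ∈-++⁺ˡ (subst (_ ∈_) (sym y₀≡) (∈-++⁺ʳ (shift (mx ∸ 1) a) (∈-map⁺ L q)))
    ... | inj₂ (here refl) = ∈-++⁺ʳ (shift (maxW b′) y₀) (here Le≡ℓ)
    S≺ : S ≺ P ++ [ e ]
    S≺ s∈ p∈ = raise-cancel-< mx (maxW a) (b′≺ (subst (_ ∈_) LS≡b′ (∈-map⁺ L s∈)) (Lp∈ p∈))
    S<mx : ∀ {s} → s ∈ S → s < mx
    S<mx s∈ = <-≤-trans (S≺ s∈ (∈-++⁺ʳ P (here refl))) (maxW-upper (∈-++⁺ʳ P (∈-++⁺ʳ S (here refl))))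
    S≡b′ : S ≡ b′
    S≡b′ = trans (sym (map-raise-< S S<mx)) LS≡b′

  redRight-inside-blueLeft : Packed x → x ≢ [] → length x ≤ length b′ → Σ Word λ x₀ → x ≡ addTop x₀
  redRight-inside-blueLeft px x≢[] x≤b′ with snocView x x≢[]
  ... | x₀ , e , refl
    with ++-suffix (shift (maxW b′) y₀) (b′ ++ [ ℓ ]) (shift (mx ∸ 1) a) (map L (x₀ ++ [ e ])) (sym E)
           (subst₂ _≤_ (sym (length-map L (x₀ ++ [ e ]))) (sym (length-++ b′)) (≤-trans x≤b′ (m≤m+n (length b′) 1)))
  ...   | V , b′ℓ≡ , _
    with ∷ʳ-injective b′ (V ++ map L x₀) (trans b′ℓ≡ (trans (cong (V ++_) (map-++ L x₀ [ e ])) (sym (++-assoc V _ _))))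
  ...     | refl , ℓ≡Le = x₀ , proj₂ (≺-last⇒addTop px x₀≺e)
    where
    x₀≺e : x₀ ≺ [ e ]
    x₀≺e {s} s∈ (here refl) = raise-cancel-< mx (maxW a)
      (subst (L s <_) ℓ≡Le (b′≺ (∈-++⁺ʳ V (∈-map⁺ L s∈)) (∈-++⁺ʳ (shift (maxW b′) y₀) (here refl))))

-- Either b′ ends inside the raised copy of x, and is then a blue left factor of x, or it covers x
-- up to its last letter, which is then the strict maximum of x and forces c = 1.
blueLeft-bounded : ∀ {x b′ y} → IsRedFact w a x → IsBlueFact x b c → IsBlueFact w b′ y → c ≢ [ 1 ] →
  length b′ ≤ length b
blueLeft-bounded {x = x} {b′} (_ , px , x≢[] , rp , _) bf@(_ , _ , _ , _ , maximal) (_ , py , _ , bp′ , _) c≢[1]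
  with BlueProd⇒blueWord bp′
... | y₀ , iy , refl , w≡ with length b′ <? length x | trans (sym (RedProd⇒redWord rp)) w≡
...   | yes b′<x | E =
        let v , pb′ , pv , v≢[] , bp = blueLeft-inside-redRight py E px b′<x
        in maximal b′ v pb′ pv v≢[] bp
...   | no b′≮x | E =
        let x₀ , x≡ = redRight-inside-blueLeft py E px x≢[] (≮⇒≥ b′≮x)
        in ⊥-elim (c≢[1] (proj₂ (blueFact-addTop px x≡ bf)))

-- For c = 1 the word w is (a ⊙ b) ◁ 1, and both maximal factorizations split off its last letter.
blueRed-of-redBlue-[1] : ∀ {x b′ y a′ c′} → Packed w → IsRedFact w a x → IsBlueFact x b [ 1 ] →
  IsBlueFact w b′ y → IsRedFact y a′ c′ → b′ ≡ a × a′ ≡ [] × c′ ≡ [ 1 ]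
blueRed-of-redBlue-[1] {a = a} {b} pw rf@(_ , _ , _ , rp , _) (_ , _ , _ , bp , _) bf′ rf′
  with redFact-addTop pw w≡ rf | blueFact-addTop pw w≡ bf′
  where
  w≡ = trans (RedProd⇒redWord rp) (trans (cong (redWord a) (BlueProd-[1] bp)) (redWord-addTop a b))
... | a≡a⊙b , _ | b′≡a⊙b , y≡[1] with redFact-addTop {u = []} (subst Packed (sym y≡[1]) Packed-[1]) y≡[1] rf′
...   | a′≡[] , c′≡[1] = trans b′≡a⊙b (sym a≡a⊙b) , a′≡[] , c′≡[1]

blueRed-of-redBlue-≢[1] : ∀ {x b′ y a′ c′} → IsRedFact w a x → IsBlueFact x b c →
  IsBlueFact w b′ y → IsRedFact y a′ c′ → c ≢ [ 1 ] → b′ ≡ b × a′ ≡ a × c′ ≡ c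
blueRed-of-redBlue-≢[1] rf@(pa , _ , _ , rp , maximal) bf@(pb , pc , c≢[] , bp , _)
                        bf′@(pb′ , _ , _ , bp′ , _) rf′@(pa′ , pc′ , c′≢[] , rp′ , _) c≢[1]
  with redBlue⇒blueRed pa pc c≢[] rp bp
... | y₀ , py₀ , y₀≢[] , bp₀ , rp₀ with blueFact-unique bf′ bp₀ pb py₀ y₀≢[] (blueLeft-bounded rf bf bf′ c≢[1])
...   | b′≡b , refl =
        let x′ , px′ , x′≢[] , rpx′ , _ = blueRed⇒redBlue pb′ pc′ c′≢[] bp′ rp′
            a′≡a , c′≡c = redFact-unique rf′ rp₀ pa pc c≢[] (maximal _ x′ pa′ px′ x′≢[] rpx′)
        in b′≡b , a′≡a , c′≡c

blueRed-of-redBlue : ∀ {b′ a′ c′} → Packed w → RBFact w a b c → BRFact w b′ a′ c′ →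
  (c ≡ [ 1 ] × b′ ≡ a × a′ ≡ [] × c′ ≡ [ 1 ]) ⊎ (c ≢ [ 1 ] × b′ ≡ b × a′ ≡ a × c′ ≡ c)
blueRed-of-redBlue {c = c} pw (_ , rf , bf) (_ , bf′ , rf′) with ≡-dec _≟_ c [ 1 ]
... | yes refl = inj₁ (refl , blueRed-of-redBlue-[1] pw rf bf bf′ rf′)
... | no c≢[1] = inj₂ (c≢[1] , blueRed-of-redBlue-≢[1] rf bf bf′ rf′ c≢[1])

-- Decomposition into irreducibles

⊙-prod-++ : ∀ ws ws′ → ⊙-prod (ws ++ ws′) ≡ ⊙-prod ws ⊙ ⊙-prod ws′
⊙-prod-++ [] ws′ = refl
⊙-prod-++ (z ∷ ws) ws′ = trans (cong (z ⊙_) (⊙-prod-++ ws ws′)) (sym (⊙-assoc z (⊙-prod ws) (⊙-prod ws′)))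

globalDescent? : ∀ w c → Dec (GlobalDescent w c)
globalDescent? w c =
  (1 ≤? c) ×-dec (c <? length w) ×-dec All.all? (λ x → All.all? (_<? x) (drop c w)) (take c w)

PackedIrreducible : Word → Set
PackedIrreducible w = Packed w × Irreducible w

irrDecomp-exists : ∀ n w → length w ≤ n → Packed w → Σ (List Word) (IrrDecomp w)
irrDecomp-exists n [] _ _ = [] , [] , refl
irrDecomp-exists (suc n) w@(_ ∷ _) |w|≤ pw with anyUpTo? (globalDescent? w) (length w)
... | no noDescent = [ w ] , (pw , (λ ()) , irreducible) ∷ [] , sym (trans (++-identityʳ (shift 0 w)) (shift-zero w))
  where
  irreducible : ¬ ∃ (GlobalDescent w)
  irreducible (c , gd) = noDescent (c , proj₁ (proj₂ gd) , gd)
... | yes (c , c<|w| , c≥1 , _ , descent) = combine (irrDecomp-exists n P′ |P′|≤n pP′) (irrDecomp-exists n S |S|≤n pS)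
  where
  P = take c w
  S = drop c w
  S≺P : S ≺ P
  S≺P s∈ p∈ = All.lookup (All.lookup descent p∈) s∈
  pPS : Packed (P ++ S)
  pPS = subst Packed (sym (take++drop≡id c w)) pw
  P′ = map (_∸ maxW S) P
  pP′ = split-Packedˡ pPS S≺P
  pS = split-Packedʳ pPS S≺P
  |P′|≤n : length P′ ≤ n
  |P′|≤n = subst (_≤ n) (sym (trans (length-map _ P) (trans (length-take c w) (m≤n⇒m⊓n≡m (<⇒≤ c<|w|)))))
             (≤-pred (≤-trans c<|w| |w|≤))
  |S|≤n : length S ≤ n
  |S|≤n = ≤-pred (≤-trans (subst (_< length w) (sym (length-drop c w)) (∸-monoʳ-< {length w} {c} {0} c≥1 (<⇒≤ c<|w|))) |w|≤)
  combine : Σ (List Word) (IrrDecomp P′) → Σ (List Word) (IrrDecomp S) → Σ (List Word) (IrrDecomp w)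
  combine (wsP , irrP , P′≡) (wsS , irrS , S≡) = wsP ++ wsS , ++⁺ irrP irrS , (begin
    w                              ≡⟨ sym (take++drop≡id c w) ⟩
    P ++ S                         ≡⟨ split-⊙ pPS S≺P ⟩
    P′ ⊙ S                         ≡⟨ cong₂ _⊙_ P′≡ S≡ ⟩
    ⊙-prod wsP ⊙ ⊙-prod wsS        ≡⟨ sym (⊙-prod-++ wsP wsS) ⟩
    ⊙-prod (wsP ++ wsS)            ∎)

⊙-shorter⇒globalDescent : ∀ w₁ w₁′ R R′ → Packed w₁ → w₁ ≢ [] → length w₁ < length w₁′ →
  w₁ ⊙ R ≡ w₁′ ⊙ R′ → GlobalDescent w₁′ (length w₁)
⊙-shorter⇒globalDescent w₁ w₁′ R R′ pw₁ w₁≢[] w₁<w₁′ E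
  with ++-suffix (shift (maxW R) w₁) R (shift (maxW R′) w₁′) R′ E |R′|≤|R|
  where
  |R′|≤|R| : length R′ ≤ length R
  |R′|≤|R| = +-cancelˡ-≤ (length w₁) _ _ (≤-trans (+-monoˡ-≤ (length R′) (<⇒≤ w₁<w₁′)) (≤-reflexive (begin
    length w₁′ + length R′  ≡⟨ sym (length-⊙ w₁′ R′) ⟩
    length (w₁′ ⊙ R′)       ≡⟨ cong length (sym E) ⟩
    length (w₁ ⊙ R)         ≡⟨ length-⊙ w₁ R ⟩
    length w₁ + length R    ∎)))
... | M , refl , e with map-++⁻ (maxW R′ +_) w₁′ (shift (maxW R) w₁) M e
...   | X , Y , refl , X≡ , refl = ≢[]⇒length≥1 w₁ w₁≢[] , w₁<w₁′ ,
        All.tabulate (λ x∈ → All.tabulate (λ y∈ → descent (subst (_ ∈_) take≡ x∈) (subst (_ ∈_) drop≡ y∈)))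
  where
  |X|≡|w₁| : length X ≡ length w₁
  |X|≡|w₁| = trans (sym (length-shift (maxW R′) X)) (trans (cong length X≡) (length-shift (maxW R) w₁))
  take≡ : take (length w₁) (X ++ Y) ≡ X
  take≡ = subst (λ n → take n (X ++ Y) ≡ X) |X|≡|w₁| (take-++-length X Y)
  drop≡ : drop (length w₁) (X ++ Y) ≡ Y
  drop≡ = subst (λ n → drop n (X ++ Y) ≡ Y) |X|≡|w₁| (drop-++-length X Y)
  descent : ∀ {x y} → x ∈ X → y ∈ Y → y < x
  descent {x} {y} x∈ y∈ with ∈-map⁻ (maxW R +_) (subst (maxW R′ + x ∈_) X≡ (∈-map⁺ (maxW R′ +_) x∈))
  ... | z , z∈ , eq = +-cancelˡ-< (maxW R′) y x (≤-trans (s≤s (maxW-upper y∈R)) (subst (suc (maxW R) ≤_) (sym eq) R<))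
    where
    R< : suc (maxW R) ≤ maxW R + z
    R< = subst (_≤ maxW R + z) (+-comm (maxW R) 1) (+-monoʳ-≤ (maxW R) (Packed-pos pw₁ z∈))
    y∈R : maxW R′ + y ∈ shift (maxW R′) Y ++ R′
    y∈R = ∈-++⁺ˡ (∈-map⁺ (maxW R′ +_) y∈)

⊙-≢[] : ∀ z R → z ≢ [] → z ⊙ R ≢ []
⊙-≢[] z R z≢[] = z≢[] ∘ map-conical ∘ ++-conicalˡ (shift (maxW R) z) R
  where
  map-conical : shift (maxW R) z ≡ [] → z ≡ []
  map-conical = length≡0⇒[] z ∘ trans (sym (length-shift (maxW R) z)) ∘ cong length

⊙-prod-injective : ∀ ws ws′ → All PackedIrreducible ws → All PackedIrreducible ws′ → ⊙-prod ws ≡ ⊙-prod ws′ → ws ≡ ws′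
⊙-prod-injective [] [] _ _ _ = refl
⊙-prod-injective [] (z ∷ ws′) _ ((_ , z≢[] , _) ∷ _) E = ⊥-elim (⊙-≢[] z (⊙-prod ws′) z≢[] (sym E))
⊙-prod-injective (z ∷ ws) [] ((_ , z≢[] , _) ∷ _) _ E = ⊥-elim (⊙-≢[] z (⊙-prod ws) z≢[] E)
⊙-prod-injective (w₁ ∷ ws) (w₁′ ∷ ws′) ((pw₁ , w₁≢[] , irr) ∷ ps) ((pw₁′ , w₁′≢[] , irr′) ∷ ps′) E
  with <-cmp (length w₁) (length w₁′)
... | tri< lt _ _ = ⊥-elim (irr′ (_ , ⊙-shorter⇒globalDescent w₁ w₁′ _ _ pw₁ w₁≢[] lt E))
... | tri> _ _ gt = ⊥-elim (irr (_ , ⊙-shorter⇒globalDescent w₁′ w₁ _ _ pw₁′ w₁′≢[] gt (sym E)))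
... | tri≈ _ eq _ with ++-cancel-length (shift (maxW (⊙-prod ws)) w₁) (shift (maxW (⊙-prod ws′)) w₁′)
                         (trans (length-shift _ w₁) (trans eq (sym (length-shift _ w₁′)))) E
...   | e₁ , e₂ = cong₂ _∷_ (shift-injective (maxW (⊙-prod ws)) (trans e₁ (cong (λ k → shift k w₁′) (cong maxW (sym e₂)))))
                            (⊙-prod-injective ws ws′ ps ps′ e₂)

-- Existence of maximal factorizations

Packed? : ∀ w → Dec (Packed w)
Packed? w = All.all? (1 ≤?_) w ×-dec map′ to from (allUpTo? (λ i → (1 ≤? i) →-dec (i ∈? w)) (suc (maxW w)))
  where
  to : (∀ {n} → n < suc (maxW w) → 1 ≤ n → n ∈ w) → ∀ i → 1 ≤ i → i ≤ maxW w → i ∈ w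
  to f i i≥1 i≤ = f (s≤s i≤) i≥1
  from : (∀ i → 1 ≤ i → i ≤ maxW w → i ∈ w) → ∀ {n} → n < suc (maxW w) → 1 ≤ n → n ∈ w
  from g {n} n< n≥1 = g n n≥1 (≤-pred n<)

largest : ∀ {C : ℕ → Set} → (∀ k → Dec (C k)) → ∀ B → C 0 → (∀ k → C k → k ≤ B) →
  Σ ℕ λ k → C k × (∀ k′ → C k′ → k′ ≤ k)
largest {C} C? zero c₀ bounded = 0 , c₀ , bounded
largest {C} C? (suc B) c₀ bounded with C? (suc B)
... | yes c = suc B , c , bounded
... | no ¬c = largest C? B c₀ bounded′
  where
  bounded′ : ∀ k → C k → k ≤ B
  bounded′ k ck with m≤n⇒m<n∨m≡n (bounded k ck)
  ... | inj₁ k<1+B = ≤-pred k<1+B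
  ... | inj₂ refl = ⊥-elim (¬c ck)

FactorOfLength : (Word → Word → Word → Set) → Word → ℕ → Set
FactorOfLength P w k = Σ Word λ u → Σ Word λ v → (Packed u × Packed v × v ≢ [] × P u v w) × length u ≡ k

maximal-IsFact : ∀ P w → (∀ k → Dec (FactorOfLength P w k)) → FactorOfLength P w 0 →
  (∀ k → FactorOfLength P w k → k ≤ length w) → Σ Word λ u → Σ Word λ v → IsFact P w u v
maximal-IsFact P w P? f₀ bounded with largest P? (length w) f₀ bounded
... | k , (u , v , (pu , pv , v≢[] , p) , refl) , max =
  u , v , pu , pv , v≢[] , p ,
  λ u′ v′ pu′ pv′ v′≢[] p′ → max (length u′) (u′ , v′ , (pu′ , pv′ , v′≢[] , p′) , refl)

lower : ℕ → ℕ → ℕ → ℕ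
lower t s y with y ≟ t
... | yes _ = s
... | no _ = y

lower-raise : ∀ j mu vs → (∀ {y} → y ∈ vs → y ≤ suc j) →
  map (lower (suc (j + mu)) (suc j)) (map (raise (suc j) mu) vs) ≡ vs
lower-raise j mu [] f = refl
lower-raise j mu (y ∷ vs) f = cong₂ _∷_ (inverse (y ≟ suc j)) (lower-raise j mu vs (f ∘ there))
  where
  lower-≡ : ∀ t s → lower t s t ≡ s
  lower-≡ t s with t ≟ t
  ... | yes _ = refl
  ... | no t≢t = ⊥-elim (t≢t refl)
  lower-≢ : ∀ {t s y} → y ≢ t → lower t s y ≡ y
  lower-≢ {t} {s} {y} y≢t with y ≟ t
  ... | yes y≡t = ⊥-elim (y≢t y≡t)
  ... | no _ = refl
  inverse : Dec (y ≡ suc j) → lower (suc (j + mu)) (suc j) (raise (suc j) mu y) ≡ y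
  inverse (yes refl) = trans (cong (lower (suc (j + mu)) (suc j)) (raise-≥ {suc j} {mu} ≤-refl)) (lower-≡ (suc (j + mu)) (suc j))
  inverse (no y≢) = trans (cong (lower (suc (j + mu)) (suc j)) (raise-< y<)) (lower-≢ (<⇒≢ (s≤s (≤-trans (≤-pred y<) (m≤m+n j mu)))))
    where
    y< : y < suc j
    y< = ≤∧≢⇒< (f (here refl)) y≢

-- A red factor (u, v) of w with |u| = k is determined by k, max v ∸ 1 and max u, all bounded by max w;
-- likewise a blue factor by k, max u and the last letter of v.  Bounded search therefore decides existence.

redCandidate : Word → ℕ → ℕ → ℕ → Word × Word
redCandidate w k j mu = map (_∸ j) (take k w) , map (lower (suc (j + mu)) (suc j)) (drop k w)

redCandidate-complete : RedProd u v w → Packed v → v ≢ [] →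
  Σ ℕ λ j → j ≤ maxW w × Σ ℕ λ mu → mu ≤ maxW w × redCandidate w (length u) j mu ≡ (u , v)
redCandidate-complete {u} {v} {w} rp pv v≢[] = j , j≤M , mu , mu≤M , cong₂ _,_ u≡ v≡
  where
  w≡ = RedProd⇒redWord rp
  j = maxW v ∸ 1
  mv≡ : maxW v ≡ suc j
  mv≡ = sym (m+[n∸m]≡n (Packed-maxW≥1 pv v≢[]))
  mu = maxW u
  L = raise (maxW v) mu
  k≡ : length u ≡ length (shift j u)
  k≡ = sym (length-shift j u)
  u≡ : map (_∸ j) (take (length u) w) ≡ u
  u≡ = trans (cong (map (_∸ j)) (trans (cong₂ take k≡ w≡) (take-++-length (shift j u) (map L v)))) (unshift j u)
  v≡ : map (lower (suc (j + mu)) (suc j)) (drop (length u) w) ≡ v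
  v≡ = trans (cong (map (lower (suc (j + mu)) (suc j))) (trans (cong₂ drop k≡ w≡)
         (trans (drop-++-length (shift j u) (map L v)) (cong (λ t → map (raise t mu) v) mv≡))))
         (lower-raise j mu v (λ y∈ → subst (_ ≤_) mv≡ (maxW-upper y∈)))
  top≤M : maxW v + mu ≤ maxW w
  top≤M = maxW-upper (subst (maxW v + mu ∈_) (sym w≡)
            (∈-++⁺ʳ (shift j u) (subst (_∈ map L v) (raise-≥ {maxW v} {mu} ≤-refl) (∈-map⁺ L (maxW-∈ v v≢[])))))
  j≤M : j ≤ maxW w
  j≤M = ≤-trans (≤-trans (m∸n≤m (maxW v) 1) (m≤m+n (maxW v) mu)) top≤M
  mu≤M : mu ≤ maxW w
  mu≤M = ≤-trans (m≤n+m mu (maxW v)) top≤M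

RedFactorOfLength : Word → ℕ → Word × Word → Set
RedFactorOfLength w k (u , v) = (Packed u × Packed v × v ≢ [] × w ≡ redWord u v) × length u ≡ k

redFactorOfLength? : ∀ w k → Dec (FactorOfLength RedProd w k)
redFactorOfLength? w k with anyUpTo? (λ j → anyUpTo? (λ mu → candidate? (redCandidate w k j mu)) (suc (maxW w))) (suc (maxW w))
  where
  candidate? : ∀ p → Dec (RedFactorOfLength w k p)
  candidate? (u , v) = (Packed? u ×-dec Packed? v ×-dec ¬? (≡-dec _≟_ v []) ×-dec ≡-dec _≟_ w (redWord u v)) ×-dec (length u ≟ k)
... | yes (j , _ , mu , _ , (pu , pv , v≢[] , w≡) , |u|≡k) =
      yes (_ , _ , (pu , pv , v≢[] , subst (RedProd _ _) (sym w≡) (redWord-RedProd _ _ pv v≢[])) , |u|≡k)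
... | no none = no witness
  where
  witness : ¬ FactorOfLength RedProd w k
  witness (u , v , (pu , pv , v≢[] , rp) , refl) with redCandidate-complete rp pv v≢[]
  ... | j , j≤M , mu , mu≤M , eq =
    none (j , s≤s j≤M , mu , s≤s mu≤M , subst (RedFactorOfLength w (length u)) (sym eq) ((pu , pv , v≢[] , RedProd⇒redWord rp) , refl))

blueCandidate : Word → ℕ → ℕ → Word × Word
blueCandidate w k mu = take k (drop (length w ∸ suc k) w) , map (_∸ mu) (take (length w ∸ suc k) w)

blueCandidate-complete : ∀ {v₀ i} → w ≡ blueWord u v₀ i →
  maxW u ≤ maxW w × i ≤ maxW w × blueCandidate w (length u) (maxW u) ≡ (u , v₀)
blueCandidate-complete {w} {u} {v₀} {i} w≡ = mu≤M , i≤M , cong₂ _,_ u≡ v₀≡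
  where
  mu = maxW u
  n≡ : length w ∸ suc (length u) ≡ length (shift mu v₀)
  n≡ = begin
    length w ∸ suc (length u)
      ≡⟨ cong (λ n → n ∸ suc (length u)) (trans (cong length w≡) (length-blueWord u v₀ i)) ⟩
    length v₀ + (length u + 1) ∸ suc (length u)    ≡⟨ cong (λ n → length v₀ + n ∸ suc (length u)) (+-comm (length u) 1) ⟩
    length v₀ + suc (length u) ∸ suc (length u)    ≡⟨ m+n∸n≡m (length v₀) (suc (length u)) ⟩
    length v₀                                      ≡⟨ sym (length-shift mu v₀) ⟩
    length (shift mu v₀)                           ∎
  u≡ : take (length u) (drop (length w ∸ suc (length u)) w) ≡ u
  u≡ = trans (cong (take (length u)) (trans (cong₂ drop n≡ w≡) (drop-++-length (shift mu v₀) (u ++ [ i + mu ]))))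
             (take-++-length u [ i + mu ])
  v₀≡ : map (_∸ mu) (take (length w ∸ suc (length u)) w) ≡ v₀
  v₀≡ = trans (cong (map (_∸ mu)) (trans (cong₂ take n≡ w≡) (take-++-length (shift mu v₀) (u ++ [ i + mu ])))) (unshift mu v₀)
  ∈w : ∀ {x} → x ∈ u ++ [ i + mu ] → x ∈ w
  ∈w x∈ = subst (_ ∈_) (sym w≡) (∈-++⁺ʳ (shift mu v₀) x∈)
  mu≤M : mu ≤ maxW w
  mu≤M = maxW-least u (maxW-upper ∘ ∈w ∘ ∈-++⁺ˡ)
  i≤M : i ≤ maxW w
  i≤M = ≤-trans (m≤m+n i mu) (maxW-upper (∈w (∈-++⁺ʳ u (here refl))))

BlueFactorOfLength : Word → ℕ → ℕ → Word × Word → Set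
BlueFactorOfLength w k i (u , v₀) = (Packed u × Packed (v₀ ++ [ i ]) × w ≡ blueWord u v₀ i) × length u ≡ k

blueFactorOfLength? : ∀ w k → Dec (FactorOfLength BlueProd w k)
blueFactorOfLength? w k with anyUpTo? (λ mu → anyUpTo? (λ i → candidate? i (blueCandidate w k mu)) (suc (maxW w))) (suc (maxW w))
  where
  candidate? : ∀ i p → Dec (BlueFactorOfLength w k i p)
  candidate? i (u , v₀) = (Packed? u ×-dec Packed? (v₀ ++ [ i ]) ×-dec ≡-dec _≟_ w (blueWord u v₀ i)) ×-dec (length u ≟ k)
... | yes (mu , _ , i , _ , (pu , pv , w≡) , |u|≡k) =
      yes (_ , _ , (pu , pv , ∷ʳ-≢[] _ i , subst (BlueProd _ _) (sym w≡) (blueWord-BlueProd _ _ i pv)) , |u|≡k)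
... | no none = no witness
  where
  witness : ¬ FactorOfLength BlueProd w k
  witness (u , v , (pu , pv , _ , bp) , refl) with BlueProd⇒blueWord bp
  ... | v₀ , i , refl , w≡ with blueCandidate-complete w≡
  ...   | mu≤M , i≤M , eq =
    none (maxW u , s≤s mu≤M , i , s≤s i≤M , subst (BlueFactorOfLength w (length u) i) (sym eq) ((pu , pv , w≡) , refl))

redFact-exists : Packed w → w ≢ [] → Σ Word λ u → Σ Word λ v → IsRedFact w u v
redFact-exists {w} pw w≢[] = maximal-IsFact RedProd w (redFactorOfLength? w) f₀ bounded
  where
  f₀ : FactorOfLength RedProd w 0
  f₀ = [] , w , (Packed-[] , pw , w≢[] , subst (RedProd [] w) (map-raise-zero (maxW w) w) (redWord-RedProd [] w pw w≢[])) , refl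
  bounded : ∀ k → FactorOfLength RedProd w k → k ≤ length w
  bounded k (u , v , (_ , _ , v≢[] , rp) , refl) = <⇒≤ (proj₁ (factor-lengths {u} {v} {w} (RedProd-length rp) v≢[]))

blueFact-exists : Packed w → w ≢ [] → Σ Word λ u → Σ Word λ v → IsBlueFact w u v
blueFact-exists {w} pw w≢[] with snocView w w≢[]
... | v₀ , i , refl = maximal-IsFact BlueProd w (blueFactorOfLength? w) f₀ bounded
  where
  f₀ : FactorOfLength BlueProd w 0
  f₀ = [] , w , (Packed-[] , pw , w≢[] , subst (BlueProd [] w) w≡ (blueWord-BlueProd [] v₀ i pw)) , refl
    where
    w≡ : blueWord [] v₀ i ≡ v₀ ++ [ i ]
    w≡ = cong₂ (λ p n → p ++ [ n ]) (shift-zero v₀) (+-identityʳ i)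
  bounded : ∀ k → FactorOfLength BlueProd w k → k ≤ length w
  bounded k (u , v , (_ , _ , v≢[] , bp) , refl) =
    <⇒≤ (proj₁ (factor-lengths {u} {v} {w} (trans (BlueProd-length bp) (+-comm (length v) (length u))) v≢[]))

-- The forests F_RB and F_BR

rbFact-exists : Packed w → w ≢ [] → Σ Word λ a → Σ Word λ b → Σ Word λ c → RBFact w a b c
rbFact-exists pw w≢[] with redFact-exists pw w≢[]
... | a , x , rf@(_ , px , x≢[] , _) with blueFact-exists px x≢[]
...   | b , c , bf = a , b , c , x , rf , bf

brFact-exists : Packed w → w ≢ [] → Σ Word λ b → Σ Word λ a → Σ Word λ c → BRFact w b a c
brFact-exists pw w≢[] with blueFact-exists pw w≢[]
... | b , y , bf@(_ , py , y≢[] , _) with redFact-exists py y≢[]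
...   | a , c , rf = b , a , c , y , bf , rf

RBFact-lengths : RBFact w a b c → length a < length w × length b < length w
RBFact-lengths (_ , rf , bf) = proj₁ (redFact-lengths rf) , <-≤-trans (proj₁ (blueFact-lengths bf)) (proj₂ (redFact-lengths rf))

BRFact-lengths : BRFact w b a c → length b < length w × length a < length w
BRFact-lengths (_ , bf , rf) = proj₁ (blueFact-lengths bf) , <-≤-trans (proj₁ (redFact-lengths rf)) (proj₂ (blueFact-lengths bf))

⊙-prod-factor-length : ∀ ws → All (λ z → length z ≤ length (⊙-prod ws)) ws
⊙-prod-factor-length [] = []
⊙-prod-factor-length (z ∷ ws) =
  subst (length z ≤_) (sym (length-⊙ z (⊙-prod ws))) (m≤m+n _ _) ∷
  All.map (λ z′≤ → ≤-trans z′≤ (subst (length (⊙-prod ws) ≤_) (sym (length-⊙ z (⊙-prod ws))) (m≤n+m _ _)))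
          (⊙-prod-factor-length ws)

IrrDecomp-factors-≤ : ∀ {n ws} → length w ≤ n → IrrDecomp w ws → All (λ z → length z ≤ n) ws
IrrDecomp-factors-≤ {ws = ws} |w|≤n (_ , refl) = All.map (λ z≤ → ≤-trans z≤ |w|≤n) (⊙-prod-factor-length ws)

All-reverse⁺ : ∀ {P : A → Set} xs → All P xs → All P (reverse xs)
All-reverse⁺ {P = P} [] [] = []
All-reverse⁺ {P = P} (x ∷ xs) (px ∷ pxs) = subst (All P) (sym (unfold-reverse x xs)) (++⁺ (All-reverse⁺ xs pxs) (px ∷ []))

module _ (n : ℕ) (tree : ∀ w → length w ≤ n → Packed w → w ≢ [] → Σ Tree (TRB w)) where

  TRBs-exists : ∀ zs → All PackedIrreducible zs → All (λ z → length z ≤ n) zs → Σ Forest (TRBs zs)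
  TRBs-exists [] [] [] = [] , []
  TRBs-exists (z ∷ zs) ((pz , z≢[] , _) ∷ ps) (z≤ ∷ ls) with tree z z≤ pz z≢[] | TRBs-exists zs ps ls
  ... | t , T | f , F = t ∷ f , T ∷ F

  FRB-exists-≤ : ∀ w → length w ≤ n → Packed w → Σ Forest (FRB w)
  FRB-exists-≤ w |w|≤n pw with irrDecomp-exists (length w) w ≤-refl pw
  ... | ws , d@(irr , _) with TRBs-exists ws irr (IrrDecomp-factors-≤ |w|≤n d)
  ...   | f , F = f , fRB d F

module _ (n : ℕ) (tree : ∀ w → length w ≤ n → Packed w → w ≢ [] → Σ Tree (TBR w)) where

  TBRs-exists : ∀ zs → All PackedIrreducible zs → All (λ z → length z ≤ n) zs → Σ Forest (TBRs zs)
  TBRs-exists [] [] [] = [] , []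
  TBRs-exists (z ∷ zs) ((pz , z≢[] , _) ∷ ps) (z≤ ∷ ls) with tree z z≤ pz z≢[] | TBRs-exists zs ps ls
  ... | t , T | f , F = t ∷ f , T ∷ F

  FBR-exists-≤ : ∀ w → length w ≤ n → Packed w → Σ Forest (FBR w)
  FBR-exists-≤ w |w|≤n pw with irrDecomp-exists (length w) w ≤-refl pw
  ... | ws , d@(irr , _) with TBRs-exists (reverse ws) (All-reverse⁺ ws irr) (All-reverse⁺ ws (IrrDecomp-factors-≤ |w|≤n d))
  ...   | f , F = f , fBR d F

TRB-exists : ∀ n w → length w ≤ n → Packed w → w ≢ [] → Σ Tree (TRB w)
TRB-exists zero [] _ _ w≢[] = ⊥-elim (w≢[] refl)
TRB-exists (suc n) w |w|≤ pw w≢[] with rbFact-exists pw w≢[]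
... | a , b , c , rb@(_ , (pa , _) , (pb , _)) with RBFact-lengths rb
...   | a< , b< with FRB-exists-≤ n (TRB-exists n) a (≤-pred (≤-trans a< |w|≤)) pa
                   | FRB-exists-≤ n (TRB-exists n) b (≤-pred (≤-trans b< |w|≤)) pb
...     | fa , FA | fb , FB = node c fa fb , tRB rb FA FB

TBR-exists : ∀ n w → length w ≤ n → Packed w → w ≢ [] → Σ Tree (TBR w)
TBR-exists zero [] _ _ w≢[] = ⊥-elim (w≢[] refl)
TBR-exists (suc n) w |w|≤ pw w≢[] with brFact-exists pw w≢[]
... | b , a , c , br@(_ , (pb , _) , (pa , _)) with BRFact-lengths br
...   | b< , a< with FBR-exists-≤ n (TBR-exists n) b (≤-pred (≤-trans b< |w|≤)) pb
                   | FBR-exists-≤ n (TBR-exists n) a (≤-pred (≤-trans a< |w|≤)) pa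
...     | fb , FB | fa , FA = node c fb fa , tBR br FB FA

mirrorT-≢[1] : ∀ c fa fb → c ≢ [ 1 ] → mirrorT (node c fa fb) ≡ node c (mirrorF fb) (mirrorF fa)
mirrorT-≢[1] c fa fb c≢[1] with ≡-dec _≟_ c [ 1 ]
... | yes c≡[1] = ⊥-elim (c≢[1] c≡[1])
... | no _ = refl

TBRs-++⁻ : ∀ xs ys {g} → TBRs (xs ++ ys) g → Σ Forest λ g₁ → Σ Forest λ g₂ → g ≡ g₁ ++ g₂ × TBRs xs g₁ × TBRs ys g₂
TBRs-++⁻ [] ys T = [] , _ , refl , [] , T
TBRs-++⁻ (x ∷ xs) ys (t ∷ T) with TBRs-++⁻ xs ys T
... | g₁ , g₂ , refl , T₁ , T₂ = _ ∷ g₁ , g₂ , refl , t ∷ T₁ , T₂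

FBR-[] : ∀ {g} → FBR [] g → g ≡ []
FBR-[] (fBR {ws = ws} (irr , e) T) with ⊙-prod-injective [] ws [] irr e
FBR-[] (fBR {ws = .[]} _ []) | refl = refl

module _ (n : ℕ) (mirror : ∀ w → length w ≤ n → Packed w → ∀ t t′ → TRB w t → TBR w t′ → t′ ≡ mirrorT t) where

  TBRs-reverse-mirror : ∀ ws {f g} → All PackedIrreducible ws → All (λ z → length z ≤ n) ws →
    TRBs ws f → TBRs (reverse ws) g → g ≡ mirrorF f
  TBRs-reverse-mirror [] [] [] [] [] = refl
  TBRs-reverse-mirror (z ∷ zs) {t ∷ f} {g} ((pz , _) ∷ ps) (z≤ ∷ ls) (T ∷ Ts) T′s
    with TBRs-++⁻ (reverse zs) [ z ] (subst (λ zs′ → TBRs zs′ g) (unfold-reverse z zs) T′s)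
  ... | g₁ , _ , refl , T′₁ , T′ ∷ [] =
    cong₂ _++_ (TBRs-reverse-mirror zs ps ls Ts T′₁) (cong [_] (mirror z z≤ pz t _ T T′))

  FBR-mirror-≤ : ∀ w → length w ≤ n → ∀ {f g} → FRB w f → FBR w g → g ≡ mirrorF f
  FBR-mirror-≤ w |w|≤n (fRB {ws = ws} d@(irr , e) Ts) (fBR {ws = ws′} (irr′ , e′) T′s)
    with ⊙-prod-injective ws ws′ irr irr′ (trans (sym e) e′)
  ... | refl = TBRs-reverse-mirror ws irr (IrrDecomp-factors-≤ |w|≤n d) Ts T′s

TBR-mirror : ∀ n w → length w ≤ n → Packed w → ∀ t t′ → TRB w t → TBR w t′ → t′ ≡ mirrorT t
TBR-mirror zero w |w|≤ _ _ _ (tRB rb _ _) _ = ⊥-elim (<⇒≱ (proj₁ (RBFact-lengths rb)) (≤-trans |w|≤ z≤n))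
TBR-mirror (suc n) w |w|≤ pw _ _ (tRB {a = a} {b} {c} {fa} {fb} rb FA FB) (tBR br FB′ FA′)
  with blueRed-of-redBlue pw rb br | RBFact-lengths rb
... | inj₁ (refl , refl , refl , refl) | a< , _ =
  cong₂ (node [ 1 ]) (FBR-mirror-≤ n (TBR-mirror n) a (≤-pred (≤-trans a< |w|≤)) FA FB′) (FBR-[] FA′)
... | inj₂ (c≢[1] , refl , refl , refl) | a< , b< =
  trans (cong₂ (node c) (FBR-mirror-≤ n (TBR-mirror n) b (≤-pred (≤-trans b< |w|≤)) FB FB′)
                        (FBR-mirror-≤ n (TBR-mirror n) a (≤-pred (≤-trans a< |w|≤)) FA FA′))
        (sym (mirrorT-≢[1] c fa fb c≢[1]))

mainTheorem8 : ∀ (w : Word) → Packed w →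
    Σ Forest (λ f → FRB w f) × Σ Forest (λ g → FBR w g) ×
    (∀ f g → FRB w f → FBR w g → g ≡ mirrorF f)
mainTheorem8 w pw =
  FRB-exists-≤ (length w) (TRB-exists (length w)) w ≤-refl pw ,
  FBR-exists-≤ (length w) (TBR-exists (length w)) w ≤-refl pw ,
  λ _ _ F G → FBR-mirror-≤ (length w) (TBR-mirror (length w)) w ≤-refl F G
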